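{- Let $r\ge1$ and assume $\mathfrak{f}=\mathfrak{m}\mathfrak{n}$ with $\mathfrak{m},\mathfrak{n}\in\mathbb{F}_q[t]$ monic, $\deg\mathfrak{m}\ge1$. Then $$[\mathfrak{n}(t)^{r-1}*\operatorname{O}^{(r)}_{\mathfrak{m}}(X_1,\dots,X_r)]\equiv\operatorname{O}^{(r)}_{\mathfrak{f}}(X_1,\dots,X_r)\pmod{(\mathfrak{m}(X_1),\dots,\mathfrak{m}(X_r))}.$$
   Context: Let $\mathbb{F}_q$ be a finite field. For a monic $\mathfrak{g}(t)=b_mt^m+\cdots+b_0\in\mathbb{F}_q[t]$ of degree $m\ge1$, define $\operatorname{D}_{\mathfrak{g}}(X^i)=\sum_{j=0}^{m-i-1}b_{i+j+1}X^j$; Weil operators $\operatorname{O}^{(1)}_{\mathfrak{g}}=1$, $\operatorname{O}^{(2)}_{\mathfrak{g}}(X_1,X_2)=\sum_{k=0}^{m-1}\operatorname{D}_{\mathfrak{g}}(X_1^k)X_2^k$, and for $s>2$, $\operatorname{O}^{(s)}_{\mathfrak{g}}(X_1,\dots,X_s)$ the unique polynomial whose degree in each $X_i$ is $<m$ and which is congruent to $\prod_{j=1}^{s-1}\operatorname{O}^{(2)}_{\mathfrak{g}}(X_j,X_s)$ modulo $\mathfrak{g}(X_s)$. For $h(t)\in\mathbb{F}_q[t]$, $[h(t)*\operatorname{O}^{(r)}_{\mathfrak{m}}]$ denotes the unique polynomial with all $X_i$-degrees $<\deg\mathfrak{m}$ congruent to $h(X_i)\operatorname{O}^{(r)}_{\mathfrak{m}}$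 modulo $(\mathfrak{m}(X_1),\dots,\mathfrak{m}(X_r))$ (independent of $i\in\{1,\dots,r\}$). -}

module Defs where

open import Level using (Level; _⊔_)
open import Algebra.Bundles using (CommutativeRing)
open import Data.Nat using (ℕ; zero; suc; _∸_; _≤_; _<_) renaming (_+_ to _+ℕ_)
open import Data.Fin using (Fin; inject₁; fromℕ) renaming (zero to fzero; suc to fsuc)
open import Data.Fin.Properties using () renaming (_≟_ to _≟F_)
open import Data.Vec using (Vec; tabulate; lookup; replicate; zipWith)
open import Data.Vec.Properties using (≡-dec)
import Data.Nat.Properties as ℕP
open import Data.List using (List; []; _∷_; _++_; map; concatMap; length; upTo; zip; foldr)
open import Data.List.Relation.Unary.Any using (Any)
open import Data.Product using (Σ; ∃; _×_; _,_)
open import Data.Empty using (⊥)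
open import Relation.Nullary using (¬_; yes; no)

module _ {c ℓ : Level} (R : CommutativeRing c ℓ) where
  open CommutativeRing R

  IsField : Set (c ⊔ ℓ)
  IsField = (¬ (0# ≈ 1#)) × (∀ x → ¬ (x ≈ 0#) → ∃ λ y → x * y ≈ 1#)

  IsFinite : Set (c ⊔ ℓ)
  IsFinite = ∃ λ (xs : List Carrier) → ∀ x → Any (x ≈_) xs

  IsFiniteField : Set (c ⊔ ℓ)
  IsFiniteField = IsField × IsFinite

module Poly {c ℓ : Level} (R : CommutativeRing c ℓ) where
  open CommutativeRing R

  -- Univariate polynomials: dense coefficient lists, constant term first.
  UPoly : Set c
  UPoly = List Carrier

  coeffU : UPoly → ℕ → Carrier
  coeffU []       _       = 0#
  coeffU (b ∷ bs) zero    = b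
  coeffU (b ∷ bs) (suc k) = coeffU bs k

  sumR : ℕ → (ℕ → Carrier) → Carrier
  sumR zero    f = 0#
  sumR (suc k) f = sumR k f + f k

  Monic : UPoly → ℕ → Set ℓ
  Monic g d = (coeffU g d ≈ 1#) × (∀ i → d < i → coeffU g i ≈ 0#)

  IsProduct : UPoly → UPoly → UPoly → Set ℓ
  IsProduct f g h = ∀ k → coeffU f k ≈ sumR (suc k) (λ j → coeffU g j * coeffU h (k ∸ j))

  mulU : UPoly → UPoly → UPoly
  mulU g h = map (λ k → sumR (suc k) (λ j → coeffU g j * coeffU h (k ∸ j))) (upTo (length g +ℕ length h))

  powU : UPoly → ℕ → UPoly
  powU h zero    = 1# ∷ []
  powU h (suc k) = mulU h (powU h k)

  -- Multivariate polynomials in r variables X_0..X_{r-1} (X_1..X_r in the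
  -- paper): formal finite sums of terms c·X^e, e an exponent vector.
  Poly : ℕ → Set c
  Poly r = List (Carrier × Vec ℕ r)

  coeff : ∀ {r} → Poly r → Vec ℕ r → Carrier
  coeff []             e = 0#
  coeff ((a , e') ∷ p) e with ≡-dec ℕP._≟_ e' e
  ... | yes _ = a + coeff p e
  ... | no  _ = coeff p e

  _≋_ : ∀ {r} → Poly r → Poly r → Set ℓ
  P ≋ Q = ∀ e → coeff P e ≈ coeff Q e

  zeroE : ∀ {r} → Vec ℕ r
  zeroE = replicate _ 0

  oneP : ∀ {r} → Poly r
  oneP = (1# , zeroE) ∷ []

  _+P_ : ∀ {r} → Poly r → Poly r → Poly r
  _+P_ = _++_

  _*P_ : ∀ {r} → Poly r → Poly r → Poly r
  P *P Q = concatMap (λ { (a , e) → map (λ { (b , e') → (a * b , zipWith _+ℕ_ e e') }) Q }) P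

  _^P_ : ∀ {r} → Poly r → ℕ → Poly r
  P ^P zero  = oneP
  P ^P suc k = P *P (P ^P k)

  sumP : ∀ {r k} → (Fin k → Poly r) → Poly r
  sumP {k = zero}  A = []
  sumP {k = suc k} A = A fzero +P sumP (λ i → A (fsuc i))

  prodP : ∀ {r k} → (Fin k → Poly r) → Poly r
  prodP {k = zero}  A = oneP
  prodP {k = suc k} A = A fzero *P prodP (λ i → A (fsuc i))

  expo2 : ∀ {r} → Fin r → ℕ → Fin r → ℕ → Vec ℕ r
  expo2 a j b k = tabulate λ l →
    (δ l a j) +ℕ (δ l b k)
    where
    δ : ∀ {r} → Fin r → Fin r → ℕ → ℕ
    δ l x n with l ≟F x
    ... | yes _ = n
    ... | no  _ = 0

  embU : ∀ {r} → UPoly → Fin r → Poly r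
  embU g i = map (λ { (k , b) → (b , expo2 i k i 0) }) (zip (upTo (length g)) g)

  CongAll : ∀ {r} → UPoly → Poly r → Poly r → Set (c ⊔ ℓ)
  CongAll {r} g P Q = ∃ λ (A : Fin r → Poly r) → P ≋ (Q +P sumP (λ i → A i *P embU g i))

  CongOne : ∀ {r} → UPoly → Fin r → Poly r → Poly r → Set (c ⊔ ℓ)
  CongOne g s P Q = ∃ λ A → P ≋ (Q +P (A *P embU g s))

  Reduced : ∀ {r} → ℕ → Poly r → Set ℓ
  Reduced d P = ∀ e → (∃ λ i → d ≤ lookup e i) → coeff P e ≈ 0#

  -- D_g(X_a^i) = Σ_{j=0}^{d-i-1} b_{i+j+1} X_a^j, multiplied by X_b^k
  -- O^{(2)}_g(X_a,X_b) = Σ_{k=0}^{d-1} D_g(X_a^k) X_b^k   (d = deg g)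
  O2 : ∀ {r} → UPoly → ℕ → Fin r → Fin r → Poly r
  O2 g d a b = concatMap (λ k → map (λ j → (coeffU g (k +ℕ j +ℕ 1) , expo2 a j b k)) (upTo (d ∸ k))) (upTo d)

  IsWeilOp : UPoly → ℕ → (s : ℕ) → Poly s → Set (c ⊔ ℓ)
  IsWeilOp g d zero P = Level.Lift _ ⊥
  IsWeilOp g d (suc zero) P = Level.Lift c (P ≋ oneP)
  IsWeilOp g d (suc (suc zero)) P = Level.Lift c (P ≋ O2 g d fzero (fsuc fzero))
  IsWeilOp g d (suc (suc (suc k))) P =
    Reduced d P ×
    CongOne g (fromℕ (suc (suc k))) P (prodP (λ (j : Fin (suc (suc k))) → O2 g d (inject₁ j) (fromℕ (suc (suc k)))))

  -- "B = [h(t) * O]" with respect to the modulus g of degree d, computed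
  -- via the variable X_i: B has all degrees < d and B ≡ h(X_i)·O mod (g(X_1),…,g(X_r)).
  IsStar : ∀ {r} → UPoly → ℕ → UPoly → Fin r → Poly r → Poly r → Set (c ⊔ ℓ)
  IsStar g d h i O B = Reduced d B × CongAll g B (embU h i *P O)

{-# OPTIONS --safe #-}
-- Work modulo the ideal I = (m(X_1), …, m(X_r)) of the polynomial ring.  Coefficient
-- comparison gives, for a ≠ b,
--   O_f(X_a, X_b) = n(X_a) O_m(X_a, X_b) + m(X_b) O_n(X_b, X_a),
--   X_a O_m(X_a, X_b) + m(X_b) = X_b O_m(X_a, X_b) + m(X_a),
-- so O_f(X_a, X_b) ≡ n(X_a) O_m(X_a, X_b) and X_a O_m(X_a, X_b) ≡ X_b O_m(X_a, X_b) mod I;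
-- by Horner's scheme the latter gives h(X_a) O_m(X_a, X_b) ≡ h(X_b) O_m(X_a, X_b) for every h.
-- Taking the product over a < r with b = r yields O^{(r)}_f ≡ n(X_r)^{r-1} O^{(r)}_m, and the
-- same rule moves n^{r-1} from X_r to any X_i.
module Submission where

open import Level using (Level; _⊔_; lift)
open import Algebra.Bundles using (CommutativeRing)
open import Data.Nat using (ℕ; zero; suc; _∸_; _≤_; _<_; _≤′_; ≤′-refl; ≤′-step; s≤s; z≤n; s≤s⁻¹; z<s) renaming (_+_ to _+ℕ_)
import Data.Nat.Properties as ℕ
open import Data.Nat.Tactic.RingSolver using (solve-∀)
open import Data.Fin using (Fin; inject₁; fromℕ) renaming (zero to fzero; suc to fsuc)
open import Data.Fin.Properties using (_≟_; all?; fromℕ≢inject₁)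
open import Data.Fin.Relation.Unary.Top using (view; ‵fromℕ; ‵inject₁)
open import Data.Vec using (Vec; lookup; zipWith; replicate; tabulate)
open import Data.Vec.Properties using (≡-dec; zipWith-comm; zipWith-assoc; zipWith-identityˡ; lookup-zipWith; lookup-replicate; lookup∘tabulate; tabulate∘lookup; tabulate-cong)
open import Data.List using (List; []; _∷_; _++_; map; concatMap; zip; length; upTo; applyUpTo)
import Data.List.Properties as List
open import Data.Product using (_×_; _,_; ∃; proj₂)
open import Data.Sum using (inj₁; inj₂; [_,_]′; swap)
open import Data.Empty using (⊥-elim)
open import Function using (_∘_; _∋_)
open import Function.Bundles using (_⇔_; mk⇔; Equivalence)
open import Relation.Nullary using (¬_; Dec; yes; no; _→-dec_; _×-dec_; ¬?)
open import Relation.Unary using (Pred; Decidable; _∈_; _∉_; ｛_｝; _∪_)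
open import Relation.Unary.Properties using (_∪?_)
open import Relation.Binary using (Rel; IsEquivalence; Setoid)
open import Relation.Binary.Definitions using (Tri; tri<; tri≈; tri>)
open import Relation.Binary.PropositionalEquality as Eq using (_≡_; _≢_)
open import Relation.Binary.PropositionalEquality.Properties using (module ≡-Reasoning)
open import Defs

module _ {r : ℕ} where

  infixl 6 _⊕_ _⊝_
  infix 4 _≤ᵉ_

  _⊕_ : Vec ℕ r → Vec ℕ r → Vec ℕ r
  _⊕_ = zipWith _+ℕ_

  _⊝_ : Vec ℕ r → Vec ℕ r → Vec ℕ r
  _⊝_ = zipWith _∸_

  _≤ᵉ_ : Vec ℕ r → Vec ℕ r → Set
  u ≤ᵉ e = ∀ l → lookup u l ≤ lookup e l

  _≤ᵉ?_ : ∀ u e → Dec (u ≤ᵉ e)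
  u ≤ᵉ? e = all? λ l → lookup u l ℕ.≤? lookup e l

  lookup-ext : ∀ {u v : Vec ℕ r} → (∀ l → lookup u l ≡ lookup v l) → u ≡ v
  lookup-ext {u} {v} eq = Eq.trans (Eq.sym (tabulate∘lookup u)) (Eq.trans (tabulate-cong eq) (tabulate∘lookup v))

  lookup-⊕ : ∀ u v l → lookup (u ⊕ v) l ≡ lookup u l +ℕ lookup v l
  lookup-⊕ u v l = lookup-zipWith _+ℕ_ l u v

  lookup-⊝ : ∀ u v l → lookup (u ⊝ v) l ≡ lookup u l ∸ lookup v l
  lookup-⊝ u v l = lookup-zipWith _∸_ l u v

  ⊕-≡⇒≤ᵉ : ∀ {u v e} → u ⊕ v ≡ e → u ≤ᵉ e
  ⊕-≡⇒≤ᵉ {u} {v} Eq.refl l = Eq.subst (lookup u l ≤_) (Eq.sym (lookup-⊕ u v l)) (ℕ.m≤m+n _ _)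

  ⊕-≡⇒⊝ : ∀ {u v e} → u ⊕ v ≡ e → v ≡ e ⊝ u
  ⊕-≡⇒⊝ {u} {v} Eq.refl = lookup-ext λ l → begin
    lookup v l                           ≡⟨ ℕ.m+n∸m≡n (lookup u l) (lookup v l) ⟨
    lookup u l +ℕ lookup v l ∸ lookup u l ≡⟨ Eq.cong (_∸ lookup u l) (lookup-⊕ u v l) ⟨
    lookup (u ⊕ v) l ∸ lookup u l         ≡⟨ lookup-⊝ (u ⊕ v) u l ⟨
    lookup (u ⊕ v ⊝ u) l                 ∎
    where open ≡-Reasoning

  ⊕-⊝ : ∀ {u e} → u ≤ᵉ e → u ⊕ (e ⊝ u) ≡ e
  ⊕-⊝ {u} {e} u≤e = lookup-ext λ l →
    Eq.trans (lookup-⊕ u (e ⊝ u) l) (Eq.trans (Eq.cong (lookup u l +ℕ_) (lookup-⊝ e u l)) (ℕ.m+[n∸m]≡n (u≤e l)))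

  ⊕-≡⇔ : ∀ {u v e} → u ≤ᵉ e → u ⊕ v ≡ e ⇔ v ≡ e ⊝ u
  ⊕-≡⇔ u≤e = mk⇔ ⊕-≡⇒⊝ λ { Eq.refl → ⊕-⊝ u≤e }

  ⊕-comm : ∀ u v → u ⊕ v ≡ v ⊕ u
  ⊕-comm = zipWith-comm ℕ.+-comm

  ⊕-assoc : ∀ u v w → u ⊕ v ⊕ w ≡ u ⊕ (v ⊕ w)
  ⊕-assoc = zipWith-assoc ℕ.+-assoc

  ⊕-identityˡ : ∀ u → replicate r 0 ⊕ u ≡ u
  ⊕-identityˡ = zipWith-identityˡ ℕ.+-identityˡ

  VanishesOff : Pred (Fin r) _ → Vec ℕ r → Set
  VanishesOff S e = ∀ l → l ∉ S → lookup e l ≡ 0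

  vanishesOff? : ∀ {S} → Decidable S → ∀ e → Dec (VanishesOff S e)
  vanishesOff? S? e = all? λ l → ¬? (S? l) →-dec lookup e l ℕ.≟ 0

  vanishesOff-agree : ∀ {S w e} → (∀ l → l ∉ S → lookup w l ≡ lookup e l) → VanishesOff S w → VanishesOff S e
  vanishesOff-agree agree w-vanishes l l∉S = Eq.trans (Eq.sym (agree l l∉S)) (w-vanishes l l∉S)

  vanishesOff-agree⇔ : ∀ {S} w e → (∀ l → l ∉ S → lookup w l ≡ lookup e l) → VanishesOff S w ⇔ VanishesOff S e
  vanishesOff-agree⇔ w e agree =
    mk⇔ (vanishesOff-agree {w = w} {e} agree) (vanishesOff-agree {w = e} {w} λ l l∉S → Eq.sym (agree l l∉S))

  vanishesOff₁? : ∀ a e → Dec (VanishesOff ｛ a ｝ e)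
  vanishesOff₁? a = vanishesOff? (a ≟_)

  vanishesOff₂? : ∀ a b e → Dec (VanishesOff (｛ a ｝ ∪ ｛ b ｝) e)
  vanishesOff₂? a b = vanishesOff? ((a ≟_) ∪? (b ≟_))

  vanishesOff-∪-comm : ∀ {S T : Pred (Fin r) _} e → VanishesOff (S ∪ T) e ⇔ VanishesOff (T ∪ S) e
  vanishesOff-∪-comm _ = mk⇔ (λ vanishes l l∉ → vanishes l (l∉ ∘ swap)) (λ vanishes l l∉ → vanishes l (l∉ ∘ swap))

  δ : Fin r → Fin r → ℕ → ℕ
  δ l a j with l ≟ a
  ... | yes _ = j
  ... | no  _ = 0

  δ-self : ∀ a j → δ a a j ≡ j
  δ-self a j with a ≟ a
  ... | yes _ = Eq.refl
  ... | no a≢a = ⊥-elim (a≢a Eq.refl)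

  δ-other : ∀ {l a} j → l ≢ a → δ l a j ≡ 0
  δ-other {l} {a} j l≢a with l ≟ a
  ... | yes l≡a = ⊥-elim (l≢a l≡a)
  ... | no  _   = Eq.refl


-- expo2 and zeroE are defined in Poly F, although they do not depend on F
module MonomialExponents {c ℓ : Level} (F : CommutativeRing c ℓ) {r : ℕ} where
  open Poly F using (expo2; zeroE)

  -- ι a k is the exponent vector of X_a^k, in the form used by embU
  ι : Fin r → ℕ → Vec ℕ r
  ι a k = expo2 a k a 0

  -- Abstracting over l ≟ a and l ≟ b reduces the local δ of expo2 and ours alike.
  lookup-expo2 : ∀ (a : Fin r) j b k l → lookup (expo2 a j b k) l ≡ δ l a j +ℕ δ l b k
  lookup-expo2 a j b k l with (lookup (expo2 a j b k) l ≡ _) ∋ lookup∘tabulate _ l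
  ... | eq with l ≟ a | l ≟ b
  ...   | yes _ | yes _ = eq
  ...   | yes _ | no  _ = eq
  ...   | no  _ | yes _ = eq
  ...   | no  _ | no  _ = eq

  lookup-zeroE : ∀ l → lookup (zeroE {r}) l ≡ 0
  lookup-zeroE l = lookup-replicate l 0

  module _ {a : Fin r} where

    lookup-ι-self : ∀ k → lookup (ι a k) a ≡ k
    lookup-ι-self k = begin
      lookup (ι a k) a   ≡⟨ lookup-expo2 a k a 0 a ⟩
      δ a a k +ℕ δ a a 0 ≡⟨ Eq.cong₂ _+ℕ_ (δ-self a k) (δ-self a 0) ⟩
      k +ℕ 0             ≡⟨ ℕ.+-identityʳ k ⟩
      k                  ∎
      where open ≡-Reasoning

    lookup-ι-other : ∀ {l} k → a ≢ l → lookup (ι a k) l ≡ 0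
    lookup-ι-other {l} k a≢l =
      Eq.trans (lookup-expo2 a k a 0 l) (Eq.cong₂ _+ℕ_ (δ-other k (a≢l ∘ Eq.sym)) (δ-other 0 (a≢l ∘ Eq.sym)))

    ι-≡⇔ : ∀ {k e} → ι a k ≡ e ⇔ (k ≡ lookup e a × VanishesOff ｛ a ｝ e)
    ι-≡⇔ {k} {e} = mk⇔ (λ { Eq.refl → Eq.sym (lookup-ι-self k) , λ l → lookup-ι-other k }) λ (k≡eₐ , vanishes) →
      lookup-ext λ l → case-on (a ≟ l) k≡eₐ vanishes
      where
      case-on : ∀ {l} → Dec (a ≡ l) → k ≡ lookup e a → VanishesOff ｛ a ｝ e → lookup (ι a k) l ≡ lookup e l
      case-on (yes Eq.refl) k≡eₐ _        = Eq.trans (lookup-ι-self k) k≡eₐ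
      case-on {l} (no a≢l) _ vanishes  = Eq.trans (lookup-ι-other k a≢l) (Eq.sym (vanishes l a≢l))

    ι-≤ᵉ⇔ : ∀ {t e} → ι a t ≤ᵉ e ⇔ t ≤ lookup e a
    ι-≤ᵉ⇔ {t} {e} = mk⇔ (λ ι≤e → Eq.subst (_≤ lookup e a) (lookup-ι-self t) (ι≤e a)) λ t≤eₐ l → bound l (a ≟ l) t≤eₐ
      where
      bound : ∀ l → Dec (a ≡ l) → t ≤ lookup e a → lookup (ι a t) l ≤ lookup e l
      bound l (yes Eq.refl) t≤eₐ = Eq.subst (_≤ lookup e a) (Eq.sym (lookup-ι-self t)) t≤eₐ
      bound l (no a≢l)   _    = Eq.subst (_≤ lookup e l) (Eq.sym (lookup-ι-other t a≢l)) z≤n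

    lookup-⊝ι-self : ∀ e t → lookup (e ⊝ ι a t) a ≡ lookup e a ∸ t
    lookup-⊝ι-self e t = Eq.trans (lookup-⊝ e (ι a t) a) (Eq.cong (lookup e a ∸_) (lookup-ι-self t))

    lookup-⊝ι-other : ∀ {l} e t → a ≢ l → lookup (e ⊝ ι a t) l ≡ lookup e l
    lookup-⊝ι-other {l} e t a≢l = Eq.trans (lookup-⊝ e (ι a t) l) (Eq.cong (lookup e l ∸_) (lookup-ι-other t a≢l))

  module _ {a b : Fin r} (a≢b : a ≢ b) where

    lookup-expo2-left : ∀ j k → lookup (expo2 a j b k) a ≡ j
    lookup-expo2-left j k = Eq.trans (lookup-expo2 a j b k a) (Eq.trans (Eq.cong₂ _+ℕ_ (δ-self a j) (δ-other k a≢b)) (ℕ.+-identityʳ j))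

    lookup-expo2-right : ∀ j k → lookup (expo2 a j b k) b ≡ k
    lookup-expo2-right j k = Eq.trans (lookup-expo2 a j b k b) (Eq.cong₂ _+ℕ_ (δ-other j (a≢b ∘ Eq.sym)) (δ-self b k))

    lookup-expo2-other : ∀ {l} j k → l ∉ ｛ a ｝ ∪ ｛ b ｝ → lookup (expo2 a j b k) l ≡ 0
    lookup-expo2-other {l} j k l∉ab =
      Eq.trans (lookup-expo2 a j b k l) (Eq.cong₂ _+ℕ_ (δ-other j (l∉ab ∘ inj₁ ∘ Eq.sym)) (δ-other k (l∉ab ∘ inj₂ ∘ Eq.sym)))

    expo2-≡⇔ : ∀ {j k e} → expo2 a j b k ≡ e ⇔ (k ≡ lookup e b × j ≡ lookup e a × VanishesOff (｛ a ｝ ∪ ｛ b ｝) e)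
    expo2-≡⇔ {j} {k} {e} = mk⇔
      (λ { Eq.refl → Eq.sym (lookup-expo2-right j k) , Eq.sym (lookup-expo2-left j k) , λ l → lookup-expo2-other j k })
      λ (k≡e_b , j≡e_a , vanishes) → lookup-ext λ l → case-on (a ≟ l) (b ≟ l) k≡e_b j≡e_a vanishes
      where
      case-on : ∀ {l} → Dec (a ≡ l) → Dec (b ≡ l) → k ≡ lookup e b → j ≡ lookup e a →
        VanishesOff (｛ a ｝ ∪ ｛ b ｝) e → lookup (expo2 a j b k) l ≡ lookup e l
      case-on (yes Eq.refl) _ _ j≡e_a _ = Eq.trans (lookup-expo2-left j k) j≡e_a
      case-on (no _) (yes Eq.refl) k≡e_b _ _ = Eq.trans (lookup-expo2-right j k) k≡e_b
      case-on {l} (no a≢l) (no b≢l) _ _ vanishes =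
        Eq.trans (lookup-expo2-other j k [ a≢l , b≢l ]′) (Eq.sym (vanishes l [ a≢l , b≢l ]′))

module RingSums {c ℓ : Level} (F : CommutativeRing c ℓ) where
  open CommutativeRing F
  open Poly F using (sumR)
  open Equivalence using (to; from)
  open import Algebra.Properties.CommutativeSemigroup +-commutativeSemigroup using () renaming (interchange to +-interchange)
  open import Relation.Binary.Reasoning.Setoid setoid

  private
    variable
      p q : Level
      P : Set p
      Q : Set q
      x y : Carrier
      u v : Level
      A : Set u
      B : Set v

  -- Opaque, so that a decision P? stays rigid and unification recovers it from goals,
  -- instead of unfolding it into its Dec record.
  opaque
    when : Dec P → Carrier → Carrier
    when (yes _) x = x
    when (no  _) _ = 0#

    when-true : {P? : Dec P} → P → when P? x ≈ x
    when-true {P? = P?} holds with P?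
    ... | yes _ = refl
    ... | no ¬holds = ⊥-elim (¬holds holds)

    when-false : {P? : Dec P} → ¬ P → when P? x ≈ 0#
    when-false {P? = P?} ¬holds with P?
    ... | yes holds = ⊥-elim (¬holds holds)
    ... | no _ = refl

    when-cong : {P? : Dec P} → (P → x ≈ y) → when P? x ≈ when P? y
    when-cong {P? = P?} eq with P?
    ... | yes holds = eq holds
    ... | no _ = refl

    when-redundant : {P? : Dec P} → (¬ P → x ≈ 0#) → when P? x ≈ x
    when-redundant {P? = P?} vanishes with P?
    ... | yes _ = refl
    ... | no ¬holds = sym (vanishes ¬holds)

    when-zero : {P? : Dec P} → when P? 0# ≈ 0#
    when-zero {P? = P?} = when-redundant {P? = P?} λ _ → refl

    when-+ : {P? : Dec P} → ∀ x y → when P? (x + y) ≈ when P? x + when P? y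
    when-+ {P? = P?} x y with P?
    ... | yes _ = refl
    ... | no _ = sym (+-identityˡ 0#)

    when-* : {P? : Dec P} → ∀ a x → when P? (a * x) ≈ a * when P? x
    when-* {P? = P?} a x with P?
    ... | yes _ = refl
    ... | no _ = sym (zeroʳ a)

    when-⇔ : {P? : Dec P} {Q? : Dec Q} → P ⇔ Q → when P? x ≈ when Q? x
    when-⇔ {P? = P?} {Q? = Q?} P⇔Q with P? | Q?
    ... | yes _ | yes _ = refl
    ... | no _  | no _  = refl
    ... | yes holds | no ¬holds = ⊥-elim (¬holds (to P⇔Q holds))
    ... | no ¬holds | yes holds = ⊥-elim (¬holds (from P⇔Q holds))

    when-when : {P? : Dec P} {Q? : Dec Q} → ∀ x → when P? (when Q? x) ≈ when (P? ×-dec Q?) x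
    when-when {P? = P?} {Q? = Q?} x with P? | Q?
    ... | yes _ | yes _ = refl
    ... | yes _ | no _  = refl
    ... | no _  | _     = refl

    when-comm : ∀ (P? : Dec P) (Q? : Dec Q) x →
      when P? (when Q? x) ≈ when Q? (when P? x)
    when-comm (yes _) (yes _) x = refl
    when-comm (yes _) (no _)  x = refl
    when-comm (no _)  (yes _) x = refl
    when-comm (no _)  (no _)  x = refl

  sumL : List A → (A → Carrier) → Carrier
  sumL []       f = 0#
  sumL (x ∷ xs) f = f x + sumL xs f

  sumL-cong : ∀ (xs : List A) {f g : A → Carrier} → (∀ x → f x ≈ g x) → sumL xs f ≈ sumL xs g
  sumL-cong []       eq = refl
  sumL-cong (x ∷ xs) eq = +-cong (eq x) (sumL-cong xs eq)

  sumL-zero : ∀ (xs : List A) {f : A → Carrier} → (∀ x → f x ≈ 0#) → sumL xs f ≈ 0#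
  sumL-zero []       _      = refl
  sumL-zero (x ∷ xs) vanish = trans (+-cong (vanish x) (sumL-zero xs vanish)) (+-identityˡ 0#)

  sumL-++ : ∀ (xs ys : List A) (f : A → Carrier) → sumL (xs ++ ys) f ≈ sumL xs f + sumL ys f
  sumL-++ []       ys f = sym (+-identityˡ _)
  sumL-++ (x ∷ xs) ys f = trans (+-congˡ (sumL-++ xs ys f)) (sym (+-assoc _ _ _))

  sumL-+ : ∀ (xs : List A) (f g : A → Carrier) → sumL xs (λ x → f x + g x) ≈ sumL xs f + sumL xs g
  sumL-+ []       f g = sym (+-identityˡ 0#)
  sumL-+ (x ∷ xs) f g = trans (+-congˡ (sumL-+ xs f g)) (+-interchange _ _ _ _)

  *-distribˡ-sumL : ∀ (xs : List A) z (f : A → Carrier) → z * sumL xs f ≈ sumL xs (λ x → z * f x)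
  *-distribˡ-sumL []       z f = zeroʳ z
  *-distribˡ-sumL (x ∷ xs) z f = trans (distribˡ z _ _) (+-congˡ (*-distribˡ-sumL xs z f))

  sumL-map : ∀ (h : B → A) (xs : List B) (f : A → Carrier) → sumL (map h xs) f ≈ sumL xs (λ x → f (h x))
  sumL-map h []       f = refl
  sumL-map h (x ∷ xs) f = +-congˡ (sumL-map h xs f)

  sumL-concatMap : ∀ (h : B → List A) (xs : List B) (f : A → Carrier) →
    sumL (concatMap h xs) f ≈ sumL xs (λ x → sumL (h x) f)
  sumL-concatMap h []       f = refl
  sumL-concatMap h (x ∷ xs) f = trans (sumL-++ (h x) (concatMap h xs) f) (+-congˡ (sumL-concatMap h xs f))

  sumL-comm : ∀ (xs : List A) (ys : List B) (f : A → B → Carrier) →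
    sumL xs (λ x → sumL ys (f x)) ≈ sumL ys (λ y → sumL xs (λ x → f x y))
  sumL-comm []       ys f = sym (sumL-zero ys λ _ → refl)
  sumL-comm (x ∷ xs) ys f = trans (+-congˡ (sumL-comm xs ys f)) (sym (sumL-+ ys (f x) _))

  sumR-cong : ∀ n {f g : ℕ → Carrier} → (∀ k → k < n → f k ≈ g k) → sumR n f ≈ sumR n g
  sumR-cong zero    eq = refl
  sumR-cong (suc n) eq = +-cong (sumR-cong n λ k k<n → eq k (ℕ.m<n⇒m<1+n k<n)) (eq n ℕ.≤-refl)

  sumR-zero : ∀ n {f : ℕ → Carrier} → (∀ k → k < n → f k ≈ 0#) → sumR n f ≈ 0#
  sumR-zero n vanish = trans (sumR-cong n vanish) (sumR-zero′ n)
    where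
    sumR-zero′ : ∀ n → sumR n (λ _ → 0#) ≈ 0#
    sumR-zero′ zero    = refl
    sumR-zero′ (suc n) = trans (+-congʳ (sumR-zero′ n)) (+-identityˡ 0#)

  sumR-extend : ∀ {n N} (f : ℕ → Carrier) → (∀ k → n ≤ k → f k ≈ 0#) → n ≤ N → sumR N f ≈ sumR n f
  sumR-extend {n} f vanish n≤N = go (ℕ.≤⇒≤′ n≤N)
    where
    go : ∀ {N} → n ≤′ N → sumR N f ≈ sumR n f
    go ≤′-refl = refl
    go (≤′-step n≤′N) = trans (+-cong (go n≤′N) (vanish _ (ℕ.≤′⇒≤ n≤′N))) (+-identityʳ _)

  sumR-cons : ∀ n (f : ℕ → Carrier) → sumR (suc n) f ≈ f 0 + sumR n (λ k → f (suc k))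
  sumR-cons zero    f = trans (+-identityˡ _) (sym (+-identityʳ _))
  sumR-cons (suc n) f = trans (+-congʳ (sumR-cons n f)) (+-assoc _ _ _)

  sumR-split : ∀ m n (f : ℕ → Carrier) → sumR (m +ℕ n) f ≈ sumR m f + sumR n (λ k → f (m +ℕ k))
  sumR-split m zero    f rewrite ℕ.+-identityʳ m = sym (+-identityʳ _)
  sumR-split m (suc n) f rewrite ℕ.+-suc m n = trans (+-congʳ (sumR-split m n f)) (+-assoc _ _ _)

  sumR-reverse : ∀ n (f : ℕ → Carrier) → sumR n f ≈ sumR n (λ k → f (n ∸ suc k))
  sumR-reverse zero    f = refl
  sumR-reverse (suc n) f = begin
    sumR n f + f n                        ≈⟨ +-congʳ (sumR-reverse n f) ⟩
    sumR n (λ k → f (n ∸ suc k)) + f n     ≈⟨ +-comm _ _ ⟩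
    f n + sumR n (λ k → f (n ∸ suc k))     ≈⟨ sumR-cons n (λ k → f (suc n ∸ suc k)) ⟨
    sumR (suc n) (λ k → f (suc n ∸ suc k)) ∎

  sumR-when : ∀ (P? : Dec P) n (f : ℕ → Carrier) → sumR n (λ k → when P? (f k)) ≈ when P? (sumR n f)
  sumR-when P? zero    f = sym when-zero
  sumR-when P? (suc n) f = trans (+-congʳ (sumR-when P? n f)) (sym (when-+ _ _))

  sumR-delta : ∀ n k (f : ℕ → Carrier) → sumR n (λ t → when (t ℕ.≟ k) (f t)) ≈ when (k ℕ.<? n) (f k)
  sumR-delta zero    k f = sym (when-false λ ())
  sumR-delta (suc n) k f = trans (+-congʳ (sumR-delta n k f)) (last-step (ℕ.<-cmp k n))
    where
    last-step : Tri (k < n) (k ≡ n) (n < k) →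
      when (k ℕ.<? n) (f k) + when (n ℕ.≟ k) (f n) ≈ when (k ℕ.<? suc n) (f k)
    last-step (tri< k<n k≢n _) = begin
      when (k ℕ.<? n) (f k) + when (n ℕ.≟ k) (f n) ≈⟨ +-cong (when-true k<n) (when-false (k≢n ∘ Eq.sym)) ⟩
      f k + 0#                                      ≈⟨ +-identityʳ _ ⟩
      f k                                           ≈⟨ when-true (ℕ.m<n⇒m<1+n k<n) ⟨
      when (k ℕ.<? suc n) (f k)                     ∎
    last-step (tri≈ k≮n Eq.refl _) = begin
      when (k ℕ.<? k) (f k) + when (k ℕ.≟ k) (f k) ≈⟨ +-cong (when-false k≮n) (when-true Eq.refl) ⟩
      0# + f k                                      ≈⟨ +-identityˡ _ ⟩
      f k                                           ≈⟨ when-true ℕ.≤-refl ⟨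
      when (k ℕ.<? suc k) (f k)                     ∎
    last-step (tri> k≮n k≢n n<k) = begin
      when (k ℕ.<? n) (f k) + when (n ℕ.≟ k) (f n) ≈⟨ +-cong (when-false k≮n) (when-false (k≢n ∘ Eq.sym)) ⟩
      0# + 0#                                       ≈⟨ +-identityˡ 0# ⟩
      0#                                            ≈⟨ when-false (ℕ.<⇒≱ n<k ∘ s≤s⁻¹) ⟨
      when (k ℕ.<? suc n) (f k)                     ∎

  sumR-truncate : ∀ L A (g h : ℕ → Carrier) → (∀ t → L ≤ t → g t ≈ 0#) →
    sumR L (λ t → g t * when (t ℕ.≤? A) (h t)) ≈ sumR (suc A) (λ t → g t * h t)
  sumR-truncate L A g h g-vanishes = begin
    sumR L G             ≈⟨ sumR-extend G (λ t L≤t → trans (*-congʳ (g-vanishes t L≤t)) (zeroˡ _)) (ℕ.m≤m+n L (suc A)) ⟨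
    sumR (L +ℕ suc A) G  ≈⟨ sumR-extend G (λ t A<t → trans (*-congˡ (when-false (ℕ.<⇒≱ A<t))) (zeroʳ _)) (ℕ.m≤n+m (suc A) L) ⟩
    sumR (suc A) G       ≈⟨ sumR-cong (suc A) (λ t t≤A → *-congˡ (when-true (s≤s⁻¹ t≤A))) ⟩
    sumR (suc A) (λ t → g t * h t) ∎
    where
    G : ℕ → Carrier
    G t = g t * when (t ℕ.≤? A) (h t)

  sumL-applyUpTo : ∀ (h : ℕ → A) n (f : A → Carrier) → sumL (applyUpTo h n) f ≈ sumR n (λ k → f (h k))
  sumL-applyUpTo h zero    f = refl
  sumL-applyUpTo h (suc n) f = trans (+-congˡ (sumL-applyUpTo (λ k → h (suc k)) n f)) (sym (sumR-cons n (λ k → f (h k))))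

module PolynomialRing {c ℓ : Level} (F : CommutativeRing c ℓ) where
  open CommutativeRing F
  open Poly F
  open RingSums F
  open import Algebra.Properties.AbelianGroup +-abelianGroup using (⁻¹-∙-comm; ε⁻¹≈ε)
  open import Relation.Binary.Reasoning.Setoid setoid

  private
    variable
      r : ℕ

  Term : ℕ → Set c
  Term r = Carrier × Vec ℕ r

  infixl 7 _⊗_
  _⊗_ : Term r → Term r → Term r
  (a , u) ⊗ (b , v) = a * b , u ⊕ v

  _≟ᵉ_ : (u v : Vec ℕ r) → Dec (u ≡ v)
  _≟ᵉ_ = ≡-dec ℕ._≟_

  termCoeff : Vec ℕ r → Term r → Carrier
  termCoeff e (a , u) = when (u ≟ᵉ e) a

  coeff-sumL : ∀ (P : Poly r) e → coeff P e ≈ sumL P (termCoeff e)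
  coeff-sumL []            e = refl
  coeff-sumL ((a , u) ∷ P) e with u ≟ᵉ e
  ... | yes u≡e = +-cong (sym (when-true u≡e)) (coeff-sumL P e)
  ... | no  u≢e = trans (coeff-sumL P e) (sym (trans (+-congʳ (when-false u≢e)) (+-identityˡ _)))

  sumL-*P : ∀ (P Q : Poly r) (f : Term r → Carrier) → sumL (P *P Q) f ≈ sumL P (λ p → sumL Q (λ q → f (p ⊗ q)))
  sumL-*P P Q f = trans (sumL-concatMap _ P f) (sumL-cong P λ { (a , u) → sumL-map _ Q f })

  coeff-*P-terms : ∀ (P Q : Poly r) e → coeff (P *P Q) e ≈ sumL P (λ p → sumL Q (λ q → termCoeff e (p ⊗ q)))
  coeff-*P-terms P Q e = trans (coeff-sumL (P *P Q) e) (sumL-*P P Q (termCoeff e))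

  termCoeff-⊗-comm : ∀ e (p q : Term r) → termCoeff e (p ⊗ q) ≈ termCoeff e (q ⊗ p)
  termCoeff-⊗-comm e (a , u) (b , v) = trans (when-cong λ _ → *-comm a b) (when-⇔ (mk⇔ (Eq.trans (⊕-comm v u)) (Eq.trans (⊕-comm u v))))

  termCoeff-⊗-assoc : ∀ e (p q s : Term r) → termCoeff e (p ⊗ q ⊗ s) ≈ termCoeff e (p ⊗ (q ⊗ s))
  termCoeff-⊗-assoc e (a , u) (b , v) (d , w) =
    trans (when-cong λ _ → *-assoc a b d) (when-⇔ (mk⇔ (Eq.trans (Eq.sym (⊕-assoc u v w))) (Eq.trans (⊕-assoc u v w))))

  termCoeff-1⊗ : ∀ e (q : Term r) → termCoeff e ((1# , zeroE) ⊗ q) ≈ termCoeff e q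
  termCoeff-1⊗ e (b , v) =
    trans (when-cong λ _ → *-identityˡ b) (when-⇔ (mk⇔ (Eq.trans (Eq.sym (⊕-identityˡ v))) (Eq.trans (⊕-identityˡ v))))

  -- the coefficient of X^e in a X^u · Q
  shiftedCoeff : Poly r → Vec ℕ r → Term r → Carrier
  shiftedCoeff Q e (a , u) = a * when (u ≤ᵉ? e) (coeff Q (e ⊝ u))

  sumL-shift : ∀ (Q : Poly r) u e → sumL Q (λ q → termCoeff e ((1# , u) ⊗ q)) ≈ when (u ≤ᵉ? e) (coeff Q (e ⊝ u))
  sumL-shift Q u e with u ≤ᵉ? e
  ... | yes u≤e = begin
    sumL Q (λ q → termCoeff e ((1# , u) ⊗ q))
      ≈⟨ sumL-cong Q (λ { (b , v) → trans (when-cong λ _ → *-identityˡ b) (when-⇔ (⊕-≡⇔ u≤e)) }) ⟩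
    sumL Q (termCoeff (e ⊝ u))
      ≈⟨ coeff-sumL Q (e ⊝ u) ⟨
    coeff Q (e ⊝ u)
      ≈⟨ when-true u≤e ⟨
    when (yes u≤e) (coeff Q (e ⊝ u)) ∎
  ... | no u≰e = trans (sumL-zero Q λ { (b , v) → when-false (u≰e ∘ ⊕-≡⇒≤ᵉ) }) (sym (when-false u≰e))

  coeff-*P : ∀ (P Q : Poly r) e → coeff (P *P Q) e ≈ sumL P (shiftedCoeff Q e)
  coeff-*P P Q e = trans (coeff-*P-terms P Q e) (sumL-cong P λ { (a , u) → begin
    sumL Q (λ q → termCoeff e ((a , u) ⊗ q))
      ≈⟨ sumL-cong Q (λ { (b , v) → trans (when-cong λ _ → *-congˡ (sym (*-identityˡ b))) (when-* a (1# * b)) }) ⟩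
    sumL Q (λ q → a * termCoeff e ((1# , u) ⊗ q))
      ≈⟨ *-distribˡ-sumL Q a _ ⟨
    a * sumL Q (λ q → termCoeff e ((1# , u) ⊗ q))
      ≈⟨ *-congˡ (sumL-shift Q u e) ⟩
    a * when (u ≤ᵉ? e) (coeff Q (e ⊝ u))                   ∎ })

  negP : Poly r → Poly r
  negP = map λ (a , u) → - a , u

  coeff-+P : ∀ (P Q : Poly r) e → coeff (P +P Q) e ≈ coeff P e + coeff Q e
  coeff-+P P Q e = begin
    coeff (P ++ Q) e                          ≈⟨ coeff-sumL (P ++ Q) e ⟩
    sumL (P ++ Q) (termCoeff e)               ≈⟨ sumL-++ P Q (termCoeff e) ⟩
    sumL P (termCoeff e) + sumL Q (termCoeff e) ≈⟨ +-cong (coeff-sumL P e) (coeff-sumL Q e) ⟨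
    coeff P e + coeff Q e                     ∎

  coeff-negP : ∀ (P : Poly r) e → coeff (negP P) e ≈ - coeff P e
  coeff-negP []            e = sym ε⁻¹≈ε
  coeff-negP ((a , u) ∷ P) e with u ≟ᵉ e
  ... | yes _ = trans (+-congˡ (coeff-negP P e)) (⁻¹-∙-comm a (coeff P e))
  ... | no  _ = coeff-negP P e

  infix 4 _≈ₚ_
  -- _≋_ as a record type, so that P and Q can be inferred from a proof of P ≈ₚ Q
  record _≈ₚ_ {r} (P Q : Poly r) : Set ℓ where
    constructor mk≈ₚ
    field coeff-≈ : P ≋ Q
  open _≈ₚ_ public

  ≈ₚ-refl : ∀ {P : Poly r} → P ≈ₚ P
  ≈ₚ-refl = mk≈ₚ λ _ → refl

  ≈ₚ-sym : ∀ {P Q : Poly r} → P ≈ₚ Q → Q ≈ₚ P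
  ≈ₚ-sym (mk≈ₚ P≋Q) = mk≈ₚ λ e → sym (P≋Q e)

  ≈ₚ-trans : ∀ {P Q S : Poly r} → P ≈ₚ Q → Q ≈ₚ S → P ≈ₚ S
  ≈ₚ-trans (mk≈ₚ P≋Q) (mk≈ₚ Q≋S) = mk≈ₚ λ e → trans (P≋Q e) (Q≋S e)

  ≡⇒≈ₚ : ∀ {P Q : Poly r} → P ≡ Q → P ≈ₚ Q
  ≡⇒≈ₚ Eq.refl = ≈ₚ-refl

  +P-identityʳ : ∀ (P : Poly r) → (P +P []) ≈ₚ P
  +P-identityʳ = ≡⇒≈ₚ ∘ List.++-identityʳ

  ≈ₚ-isEquivalence : IsEquivalence (_≈ₚ_ {r})
  ≈ₚ-isEquivalence = record
    { refl  = ≈ₚ-refl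
    ; sym   = ≈ₚ-sym
    ; trans = ≈ₚ-trans
    }

  +P-cong : ∀ {P P′ Q Q′ : Poly r} → P ≈ₚ P′ → Q ≈ₚ Q′ → (P +P Q) ≈ₚ (P′ +P Q′)
  +P-cong {P = P} {P′} {Q} {Q′} (mk≈ₚ P≋P′) (mk≈ₚ Q≋Q′) = mk≈ₚ λ e →
    trans (coeff-+P P Q e) (trans (+-cong (P≋P′ e) (Q≋Q′ e)) (sym (coeff-+P P′ Q′ e)))

  +P-comm : ∀ (P Q : Poly r) → (P +P Q) ≈ₚ (Q +P P)
  +P-comm P Q = mk≈ₚ λ e → trans (coeff-+P P Q e) (trans (+-comm _ _) (sym (coeff-+P Q P e)))

  negP-cong : ∀ {P Q : Poly r} → P ≈ₚ Q → negP P ≈ₚ negP Q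
  negP-cong {P = P} {Q} (mk≈ₚ P≋Q) = mk≈ₚ λ e → trans (coeff-negP P e) (trans (-‿cong (P≋Q e)) (sym (coeff-negP Q e)))

  negP-inverseˡ : ∀ (P : Poly r) → (negP P +P P) ≈ₚ []
  negP-inverseˡ P = mk≈ₚ λ e → trans (coeff-+P (negP P) P e) (trans (+-congʳ (coeff-negP P e)) (-‿inverseˡ _))

  *P-comm : ∀ (P Q : Poly r) → (P *P Q) ≈ₚ (Q *P P)
  *P-comm P Q = mk≈ₚ λ e → begin
    coeff (P *P Q) e
      ≈⟨ coeff-*P-terms P Q e ⟩
    sumL P (λ p → sumL Q (λ q → termCoeff e (p ⊗ q)))
      ≈⟨ sumL-comm P Q _ ⟩
    sumL Q (λ q → sumL P (λ p → termCoeff e (p ⊗ q)))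
      ≈⟨ sumL-cong Q (λ q → sumL-cong P λ p → termCoeff-⊗-comm e p q) ⟩
    sumL Q (λ q → sumL P (λ p → termCoeff e (q ⊗ p)))
      ≈⟨ coeff-*P-terms Q P e ⟨
    coeff (Q *P P) e ∎

  *P-assoc : ∀ (P Q S : Poly r) → (P *P Q) *P S ≈ₚ P *P (Q *P S)
  *P-assoc P Q S = mk≈ₚ λ e → begin
    coeff ((P *P Q) *P S) e
      ≈⟨ coeff-*P-terms (P *P Q) S e ⟩
    sumL (P *P Q) (λ t → sumL S (λ s → termCoeff e (t ⊗ s)))
      ≈⟨ sumL-*P P Q _ ⟩
    sumL P (λ p → sumL Q (λ q → sumL S (λ s → termCoeff e (p ⊗ q ⊗ s))))
      ≈⟨ sumL-cong P (λ p → sumL-cong Q λ q → sumL-cong S λ s → termCoeff-⊗-assoc e p q s) ⟩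
    sumL P (λ p → sumL Q (λ q → sumL S (λ s → termCoeff e (p ⊗ (q ⊗ s)))))
      ≈⟨ sumL-cong P (λ p → sumL-*P Q S _) ⟨
    sumL P (λ p → sumL (Q *P S) (λ t → termCoeff e (p ⊗ t)))
      ≈⟨ coeff-*P-terms P (Q *P S) e ⟨
    coeff (P *P (Q *P S)) e ∎

  *P-identityˡ : ∀ (P : Poly r) → (oneP *P P) ≈ₚ P
  *P-identityˡ P = mk≈ₚ λ e → begin
    coeff (oneP *P P) e
      ≈⟨ coeff-*P-terms oneP P e ⟩
    sumL P (λ q → termCoeff e ((1# , zeroE) ⊗ q)) + 0#
      ≈⟨ +-identityʳ _ ⟩
    sumL P (λ q → termCoeff e ((1# , zeroE) ⊗ q))
      ≈⟨ sumL-cong P (termCoeff-1⊗ e) ⟩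
    sumL P (termCoeff e)
      ≈⟨ coeff-sumL P e ⟨
    coeff P e ∎

  *P-identityʳ : ∀ (P : Poly r) → (P *P oneP) ≈ₚ P
  *P-identityʳ P = mk≈ₚ λ e → trans (coeff-≈ (*P-comm P oneP) e) (coeff-≈ (*P-identityˡ P) e)

  *P-distribʳ : ∀ (S P Q : Poly r) → (P +P Q) *P S ≈ₚ (P *P S) +P (Q *P S)
  *P-distribʳ S P Q = mk≈ₚ λ e → begin
    coeff ((P ++ Q) *P S) e
      ≈⟨ coeff-*P-terms (P ++ Q) S e ⟩
    sumL (P ++ Q) (λ p → sumL S (λ s → termCoeff e (p ⊗ s)))
      ≈⟨ sumL-++ P Q _ ⟩
    sumL P (λ p → sumL S (λ s → termCoeff e (p ⊗ s))) + sumL Q (λ p → sumL S (λ s → termCoeff e (p ⊗ s)))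
                                                                           ≈⟨ +-cong (coeff-*P-terms P S e) (coeff-*P-terms Q S e) ⟨
    coeff (P *P S) e + coeff (Q *P S) e
      ≈⟨ coeff-+P (P *P S) (Q *P S) e ⟨
    coeff ((P *P S) +P (Q *P S)) e ∎

  *P-congˡ : ∀ (P : Poly r) {Q Q′ : Poly r} → Q ≈ₚ Q′ → (P *P Q) ≈ₚ (P *P Q′)
  *P-congˡ P {Q} {Q′} (mk≈ₚ Q≋Q′) = mk≈ₚ λ e → begin
    coeff (P *P Q) e
      ≈⟨ coeff-*P P Q e ⟩
    sumL P (shiftedCoeff Q e)
      ≈⟨ sumL-cong P (λ { (a , u) → *-congˡ (when-cong λ _ → Q≋Q′ (e ⊝ u)) }) ⟩
    sumL P (shiftedCoeff Q′ e)
      ≈⟨ coeff-*P P Q′ e ⟨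
    coeff (P *P Q′) e ∎

  ≈ₚ-setoid : ℕ → Setoid c ℓ
  ≈ₚ-setoid r = record { isEquivalence = ≈ₚ-isEquivalence {r} }

  polynomialRing : ℕ → CommutativeRing c ℓ
  polynomialRing r = record
    { Carrier = Poly r
    ; _≈_ = _≈ₚ_
    ; _+_ = _+P_
    ; _*_ = _*P_
    ; -_ = negP
    ; 0# = []
    ; 1# = oneP
    ; isCommutativeRing = record
      { isRing = record
        { +-isAbelianGroup = record
          { isGroup = record
            { isMonoid = record
              { isSemigroup = record
                { isMagma = record { isEquivalence = ≈ₚ-isEquivalence ; ∙-cong = +P-cong }
                ; assoc = λ P Q S → ≡⇒≈ₚ (List.++-assoc P Q S)
                }
              ; identity = (λ _ → ≈ₚ-refl) , +P-identityʳ
              }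
            ; inverse = comm∧invˡ⇒inv +P-comm negP-inverseˡ
            ; ⁻¹-cong = negP-cong
            }
          ; comm = +P-comm
          }
        ; *-cong = λ {P} {P′} {Q} {Q′} P≈P′ Q≈Q′ →
            ≈ₚ-trans (*P-congˡ P Q≈Q′) (≈ₚ-trans (*P-comm P Q′) (≈ₚ-trans (*P-congˡ Q′ P≈P′) (*P-comm Q′ P′)))
        ; *-assoc = *P-assoc
        ; *-identity = *P-identityˡ , *P-identityʳ
        ; distrib = comm∧distrʳ⇒distr +P-cong *P-comm *P-distribʳ
        }
      ; *-comm = *P-comm
      }
    }
    where
    open import Algebra.Consequences.Setoid (≈ₚ-setoid r)

∸-low-index : ∀ {q t} p → t ≤ q → q +ℕ p +ℕ 1 ∸ t ≡ p +ℕ (q ∸ t) +ℕ 1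
∸-low-index {q} {t} p t≤q = begin
  q +ℕ p +ℕ 1 ∸ t                 ≡⟨ Eq.cong (λ x → x +ℕ p +ℕ 1 ∸ t) (ℕ.m+[n∸m]≡n t≤q) ⟨
  t +ℕ (q ∸ t) +ℕ p +ℕ 1 ∸ t      ≡⟨ Eq.cong (_∸ t) (rearrange t (q ∸ t) p) ⟩
  t +ℕ (p +ℕ (q ∸ t) +ℕ 1) ∸ t    ≡⟨ ℕ.m+n∸m≡n t _ ⟩
  p +ℕ (q ∸ t) +ℕ 1               ∎
  where
  open ≡-Reasoning
  rearrange : ∀ t s p → t +ℕ s +ℕ p +ℕ 1 ≡ t +ℕ (p +ℕ s +ℕ 1)
  rearrange = solve-∀

∸-high-index : ∀ {p t} q → t ≤ p → q +ℕ p +ℕ 1 ∸ (suc q +ℕ (p ∸ t)) ≡ t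
∸-high-index {p} {t} q t≤p = begin
  q +ℕ p +ℕ 1 ∸ (suc q +ℕ (p ∸ t))                   ≡⟨ Eq.cong (λ x → q +ℕ x +ℕ 1 ∸ (suc q +ℕ (p ∸ t))) (ℕ.m∸n+n≡m t≤p) ⟨
  q +ℕ (p ∸ t +ℕ t) +ℕ 1 ∸ (suc q +ℕ (p ∸ t))         ≡⟨ Eq.cong (_∸ (suc q +ℕ (p ∸ t))) (rearrange q (p ∸ t) t) ⟩
  suc q +ℕ (p ∸ t) +ℕ t ∸ (suc q +ℕ (p ∸ t))          ≡⟨ ℕ.m+n∸m≡n (suc q +ℕ (p ∸ t)) t ⟩
  t                                                   ∎
  where
  open ≡-Reasoning
  rearrange : ∀ q s t → q +ℕ (s +ℕ t) +ℕ 1 ≡ suc q +ℕ s +ℕ t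
  rearrange = solve-∀

module OperatorIdentities {c ℓ : Level} (F : CommutativeRing c ℓ) where
  open CommutativeRing F
  open Poly F
  open RingSums F
  open MonomialExponents F
  open PolynomialRing F
  open import Relation.Binary.Reasoning.Setoid setoid

  private
    variable
      r : ℕ

  DegreeAtMost : UPoly → ℕ → Set ℓ
  DegreeAtMost g d = ∀ i → d < i → coeffU g i ≈ 0#

  coeffU-length : ∀ (g : UPoly) {t} → length g ≤ t → coeffU g t ≈ 0#
  coeffU-length []      _   = refl
  coeffU-length (_ ∷ g) {suc t} 1+len≤1+t = coeffU-length g (s≤s⁻¹ 1+len≤1+t)

  sumL-zip-applyUpTo : ∀ (h : ℕ → ℕ) (g : UPoly) (f : ℕ × Carrier → Carrier) →
    sumL (zip (applyUpTo h (length g)) g) f ≈ sumR (length g) (λ t → f (h t , coeffU g t))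
  sumL-zip-applyUpTo h []      f = refl
  sumL-zip-applyUpTo h (x ∷ g) f =
    trans (+-congˡ (sumL-zip-applyUpTo (h ∘ suc) g f)) (sym (sumR-cons (length g) (λ t → f (h t , coeffU (x ∷ g) t))))

  sumL-embU : ∀ (g : UPoly) (a : Fin r) (f : Term r → Carrier) →
    sumL (embU g a) f ≈ sumR (length g) (λ t → f (coeffU g t , ι a t))
  sumL-embU g a f = trans (sumL-map _ (zip (upTo (length g)) g) f) (sumL-zip-applyUpTo (λ t → t) g _)

  sumL-O2 : ∀ (g : UPoly) d (a b : Fin r) (f : Term r → Carrier) →
    sumL (O2 g d a b) f ≈ sumR d (λ k → sumR (d ∸ k) (λ j → f (coeffU g (k +ℕ j +ℕ 1) , expo2 a j b k)))
  sumL-O2 g d a b f = begin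
    sumL (O2 g d a b) f ≈⟨ sumL-concatMap _ (upTo d) f ⟩
    sumL (upTo d) (λ k → sumL (map (λ j → coeffU g (k +ℕ j +ℕ 1) , expo2 a j b k) (upTo (d ∸ k))) f)
      ≈⟨ sumL-applyUpTo (λ k → k) d _ ⟩
    sumR d (λ k → sumL (map (λ j → coeffU g (k +ℕ j +ℕ 1) , expo2 a j b k) (upTo (d ∸ k))) f)
      ≈⟨ sumR-cong d (λ k _ → trans (sumL-map _ (upTo (d ∸ k)) f) (sumL-applyUpTo (λ j → j) (d ∸ k) _)) ⟩
    sumR d (λ k → sumR (d ∸ k) (λ j → f (coeffU g (k +ℕ j +ℕ 1) , expo2 a j b k))) ∎

  coeff-embU : ∀ (g : UPoly) (a : Fin r) e → coeff (embU g a) e ≈ when (vanishesOff₁? a e) (coeffU g (lookup e a))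
  coeff-embU g a e = begin
    coeff (embU g a) e
      ≈⟨ coeff-sumL (embU g a) e ⟩
    sumL (embU g a) (termCoeff e)
      ≈⟨ sumL-embU g a (termCoeff e) ⟩
    sumR (length g) (λ t → when (ι a t ≟ᵉ e) (coeffU g t))
      ≈⟨ sumR-cong (length g) (λ t _ → trans (when-⇔ ι-≡⇔) (sym (when-when _))) ⟩
    sumR (length g) (λ t → when (t ℕ.≟ A) (when V? (coeffU g t)))
      ≈⟨ sumR-delta (length g) A _ ⟩
    when (A ℕ.<? length g) (when V? (coeffU g A))
      ≈⟨ when-redundant (λ A≮len → trans (when-cong λ _ → coeffU-length g (ℕ.≮⇒≥ A≮len)) when-zero) ⟩
    when V? (coeffU g A) ∎
    where
    A = lookup e a
    V? = vanishesOff₁? a e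

  coeff-O2 : ∀ {r} (g : UPoly) d {a b : Fin r} → a ≢ b → DegreeAtMost g d → ∀ e →
    coeff (O2 g d a b) e ≈ when (vanishesOff₂? a b e) (coeffU g (lookup e b +ℕ lookup e a +ℕ 1))
  coeff-O2 {r} g d {a} {b} a≢b deg≤d e = begin
    coeff (O2 g d a b) e
      ≈⟨ trans (coeff-sumL (O2 g d a b) e) (sumL-O2 g d a b (termCoeff e)) ⟩
    sumR d (λ k → sumR (d ∸ k) (λ j → when (expo2 a j b k ≟ᵉ e) (coeffU g (k +ℕ j +ℕ 1))))
      ≈⟨ sumR-cong d (λ k _ → sumR-cong (d ∸ k) λ j _ → trans (when-⇔ (expo2-≡⇔ a≢b)) (sym (trans (when-cong λ _ → when-when _) (when-when _)))) ⟩
    sumR d (λ k → sumR (d ∸ k) (λ j → when (k ℕ.≟ B) (when (j ℕ.≟ A) (X k j))))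
      ≈⟨ sumR-cong d (λ k _ → sumR-when (k ℕ.≟ B) (d ∸ k) _) ⟩
    sumR d (λ k → when (k ℕ.≟ B) (sumR (d ∸ k) (λ j → when (j ℕ.≟ A) (X k j))))
      ≈⟨ sumR-delta d B _ ⟩
    when (B ℕ.<? d) (sumR (d ∸ B) (λ j → when (j ℕ.≟ A) (X B j)))
      ≈⟨ when-cong (λ _ → sumR-delta (d ∸ B) A _) ⟩
    when (B ℕ.<? d) (when (A ℕ.<? d ∸ B) (X B A))
      ≈⟨ when-redundant (λ B≮d → trans (when-cong λ _ → X-beyond (B≮d⇒ B≮d)) when-zero) ⟩
    when (A ℕ.<? d ∸ B) (X B A)
      ≈⟨ when-redundant (X-beyond ∘ A≮d∸B⇒) ⟩
    X B A ∎
    where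
    A = lookup e a
    B = lookup e b
    X : ℕ → ℕ → Carrier
    X k j = when (vanishesOff₂? a b e) (coeffU g (k +ℕ j +ℕ 1))
    X-beyond : d < B +ℕ A +ℕ 1 → X B A ≈ 0#
    X-beyond d<deg = trans (when-cong λ _ → deg≤d _ d<deg) when-zero
    B≮d⇒ : ¬ B < d → d < B +ℕ A +ℕ 1
    B≮d⇒ B≮d = ℕ.≤-<-trans (ℕ.≤-trans (ℕ.≮⇒≥ B≮d) (ℕ.m≤m+n B A)) (ℕ.m<m+n (B +ℕ A) z<s)
    A≮d∸B⇒ : ¬ A < d ∸ B → d < B +ℕ A +ℕ 1
    A≮d∸B⇒ A≮d∸B = ℕ.≤-<-trans (ℕ.≤-trans (ℕ.m≤n+m∸n d B) (ℕ.+-monoʳ-≤ B (ℕ.≮⇒≥ A≮d∸B))) (ℕ.m<m+n (B +ℕ A) z<s)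

  coeff-embU-*P : ∀ (g : UPoly) (a : Fin r) (Q : Poly r) e →
    coeff (embU g a *P Q) e ≈ sumR (length g) (λ t → coeffU g t * when (t ℕ.≤? lookup e a) (coeff Q (e ⊝ ι a t)))
  coeff-embU-*P g a Q e = begin
    coeff (embU g a *P Q) e                      ≈⟨ coeff-*P (embU g a) Q e ⟩
    sumL (embU g a) (shiftedCoeff Q e)           ≈⟨ sumL-embU g a (shiftedCoeff Q e) ⟩
    sumR (length g) (λ t → coeffU g t * when (ι a t ≤ᵉ? e) (coeff Q (e ⊝ ι a t)))
                                                 ≈⟨ sumR-cong (length g) (λ t _ → *-congˡ (when-⇔ (ι-≤ᵉ⇔ {a = a} {t} {e}))) ⟩
    sumR (length g) (λ t → coeffU g t * when (t ℕ.≤? lookup e a) (coeff Q (e ⊝ ι a t))) ∎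

  coeff-embU-*P-supported : ∀ (g : UPoly) (a : Fin r) (Q : Poly r) {S : Pred (Fin r) _} (S? : Decidable S) → a ∈ S →
    ∀ e (φ : ℕ → Carrier) →
    (∀ t → t ≤ lookup e a → coeff Q (e ⊝ ι a t) ≈ when (vanishesOff? S? (e ⊝ ι a t)) (φ t)) →
    coeff (embU g a *P Q) e ≈ when (vanishesOff? S? e) (sumR (suc (lookup e a)) (λ t → coeffU g t * φ t))
  coeff-embU-*P-supported g a Q {S} S? a∈S e φ coeff-Q = begin
    coeff (embU g a *P Q) e
      ≈⟨ coeff-embU-*P g a Q e ⟩
    sumR (length g) (λ t → coeffU g t * when (t ℕ.≤? A) (coeff Q (e ⊝ ι a t)))
      ≈⟨ sumR-cong (length g) (λ t _ → *-congˡ (when-cong λ t≤A → trans (coeff-Q t t≤A) (when-⇔ (vanishesOff-agree⇔ {S = S} (e ⊝ ι a t) e (agree t))))) ⟩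
    sumR (length g) (λ t → coeffU g t * when (t ℕ.≤? A) (when V? (φ t)))
      ≈⟨ sumR-cong (length g) (λ t _ → trans (*-congˡ (when-comm (t ℕ.≤? A) V? (φ t))) (sym (when-* _ _))) ⟩
    sumR (length g) (λ t → when V? (coeffU g t * when (t ℕ.≤? A) (φ t)))
      ≈⟨ sumR-when V? (length g) _ ⟩
    when V? (sumR (length g) (λ t → coeffU g t * when (t ℕ.≤? A) (φ t)))
      ≈⟨ when-cong (λ _ → sumR-truncate (length g) A (coeffU g) φ (λ t → coeffU-length g)) ⟩
    when V? (sumR (suc A) (λ t → coeffU g t * φ t)) ∎
    where
    A = lookup e a
    V? = vanishesOff? S? e
    agree : ∀ t l → l ∉ S → lookup (e ⊝ ι a t) l ≡ lookup e l
    agree t l l∉S = lookup-⊝ι-other e t λ { Eq.refl → l∉S a∈S }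

  embU-*P : ∀ {f g h : UPoly} → IsProduct f g h → ∀ (a : Fin r) → embU f a ≈ₚ (embU g a *P embU h a)
  embU-*P {f = f} {g} {h} f≈gh a = mk≈ₚ λ e → begin
    coeff (embU f a) e
      ≈⟨ coeff-embU f a e ⟩
    when (vanishesOff₁? a e) (coeffU f (lookup e a))
      ≈⟨ when-cong (λ _ → f≈gh (lookup e a)) ⟩
    when (vanishesOff₁? a e) (sumR (suc (lookup e a)) (λ t → coeffU g t * coeffU h (lookup e a ∸ t)))
      ≈⟨ coeff-embU-*P-supported g a (embU h a) (a ≟_) Eq.refl e _ (coeff-embU-shifted e) ⟨
    coeff (embU g a *P embU h a) e ∎
    where
    coeff-embU-shifted : ∀ e t → t ≤ lookup e a →
      coeff (embU h a) (e ⊝ ι a t) ≈ when (vanishesOff₁? a (e ⊝ ι a t)) (coeffU h (lookup e a ∸ t))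
    coeff-embU-shifted e t _ = trans (coeff-embU h a (e ⊝ ι a t)) (when-cong λ _ → reflexive (Eq.cong (coeffU h) (lookup-⊝ι-self e t)))

  coeff-embU-*P-O2 : ∀ (h g : UPoly) d {a b : Fin r} → a ≢ b → DegreeAtMost g d → ∀ e →
    coeff (embU h a *P O2 g d a b) e ≈
      when (vanishesOff₂? a b e) (sumR (suc (lookup e a)) (λ t → coeffU h t * coeffU g (lookup e b +ℕ (lookup e a ∸ t) +ℕ 1)))
  coeff-embU-*P-O2 h g d {a} {b} a≢b deg≤d e =
    coeff-embU-*P-supported h a (O2 g d a b) ((a ≟_) ∪? (b ≟_)) (inj₁ Eq.refl) e _ λ t _ →
      trans (coeff-O2 g d a≢b deg≤d (e ⊝ ι a t))
            (when-cong λ _ → reflexive (Eq.cong (λ i → coeffU g (i +ℕ 1))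
              (Eq.cong₂ _+ℕ_ (lookup-⊝ι-other e t a≢b) (lookup-⊝ι-self e t))))

  convolution-split : ∀ (f g h : UPoly) → IsProduct f g h → ∀ p q →
    coeffU f (q +ℕ p +ℕ 1) ≈
      sumR (suc p) (λ t → coeffU h t * coeffU g (q +ℕ (p ∸ t) +ℕ 1)) + sumR (suc q) (λ t → coeffU g t * coeffU h (p +ℕ (q ∸ t) +ℕ 1))
  convolution-split f g h f≈gh p q = begin
    coeffU f N                                                           ≈⟨ f≈gh N ⟩
    sumR (suc N) G                                                       ≡⟨ Eq.cong (λ n → sumR n G) (1+N≡ q p) ⟩
    sumR (suc q +ℕ suc p) G                                              ≈⟨ sumR-split (suc q) (suc p) G ⟩
    sumR (suc q) G + sumR (suc p) (λ s → G (suc q +ℕ s))                 ≈⟨ +-congˡ (sumR-reverse (suc p) _) ⟩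
    sumR (suc q) G + sumR (suc p) (λ t → G (suc q +ℕ (p ∸ t)))           ≈⟨ +-cong (sumR-cong (suc q) low) (sumR-cong (suc p) high) ⟩
    sumR (suc q) (λ t → coeffU g t * coeffU h (p +ℕ (q ∸ t) +ℕ 1))
      + sumR (suc p) (λ t → coeffU h t * coeffU g (q +ℕ (p ∸ t) +ℕ 1))    ≈⟨ +-comm _ _ ⟩
    sumR (suc p) (λ t → coeffU h t * coeffU g (q +ℕ (p ∸ t) +ℕ 1))
      + sumR (suc q) (λ t → coeffU g t * coeffU h (p +ℕ (q ∸ t) +ℕ 1))    ∎
    where
    N = q +ℕ p +ℕ 1
    G : ℕ → Carrier
    G j = coeffU g j * coeffU h (N ∸ j)
    1+N≡ : ∀ q p → suc (q +ℕ p +ℕ 1) ≡ suc q +ℕ suc p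
    1+N≡ = solve-∀
    low : ∀ t → t < suc q → G t ≈ coeffU g t * coeffU h (p +ℕ (q ∸ t) +ℕ 1)
    low t t≤q = *-congˡ (reflexive (Eq.cong (coeffU h) (∸-low-index p (s≤s⁻¹ t≤q))))
    high : ∀ t → t < suc p → G (suc q +ℕ (p ∸ t)) ≈ coeffU h t * coeffU g (q +ℕ (p ∸ t) +ℕ 1)
    high t t≤p = trans (*-cong (reflexive (Eq.cong (coeffU g) (suc-+ q (p ∸ t))))
                               (reflexive (Eq.cong (coeffU h) (∸-high-index q (s≤s⁻¹ t≤p)))))
                       (*-comm _ _)
      where
      suc-+ : ∀ q s → suc q +ℕ s ≡ q +ℕ s +ℕ 1
      suc-+ = solve-∀

  O2-*P : ∀ {f m n : UPoly} {df dm dn} {a b : Fin r} → a ≢ b →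
    DegreeAtMost f df → DegreeAtMost m dm → DegreeAtMost n dn → IsProduct f m n →
    O2 f df a b ≈ₚ ((embU n a *P O2 m dm a b) +P (embU m b *P O2 n dn b a))
  O2-*P {f = f} {m} {n} {df} {dm} {dn} {a} {b} a≢b deg-f deg-m deg-n f≈mn = mk≈ₚ λ e → begin
    coeff (O2 f df a b) e
      ≈⟨ coeff-O2 f df a≢b deg-f e ⟩
    when (vanishesOff₂? a b e) (coeffU f (lookup e b +ℕ lookup e a +ℕ 1))
      ≈⟨ trans (when-cong λ _ → convolution-split f m n f≈mn (lookup e a) (lookup e b)) (when-+ _ _) ⟩
    when (vanishesOff₂? a b e) (sumR (suc (lookup e a)) (λ t → coeffU n t * coeffU m (lookup e b +ℕ (lookup e a ∸ t) +ℕ 1)))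
      + when (vanishesOff₂? a b e) (sumR (suc (lookup e b)) (λ t → coeffU m t * coeffU n (lookup e a +ℕ (lookup e b ∸ t) +ℕ 1)))
      ≈⟨ +-cong (coeff-embU-*P-O2 n m dm a≢b deg-m e) (trans (coeff-embU-*P-O2 m n dn (a≢b ∘ Eq.sym) deg-n e) (when-⇔ (vanishesOff-∪-comm e))) ⟨
    coeff (embU n a *P O2 m dm a b) e + coeff (embU m b *P O2 n dn b a) e
      ≈⟨ coeff-+P (embU n a *P O2 m dm a b) (embU m b *P O2 n dn b a) e ⟨
    coeff ((embU n a *P O2 m dm a b) +P (embU m b *P O2 n dn b a)) e ∎

  O2-sym : ∀ (g : UPoly) d {a b : Fin r} → a ≢ b → DegreeAtMost g d → O2 g d a b ≈ₚ O2 g d b a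
  O2-sym g d {a} {b} a≢b deg≤d = mk≈ₚ λ e → begin
    coeff (O2 g d a b) e
      ≈⟨ coeff-O2 g d a≢b deg≤d e ⟩
    when (vanishesOff₂? a b e) (coeffU g (lookup e b +ℕ lookup e a +ℕ 1))
      ≈⟨ when-⇔ (vanishesOff-∪-comm e) ⟩
    when (vanishesOff₂? b a e) (coeffU g (lookup e b +ℕ lookup e a +ℕ 1))
      ≡⟨ Eq.cong (λ i → when (vanishesOff₂? b a e) (coeffU g (i +ℕ 1))) (ℕ.+-comm (lookup e b) (lookup e a)) ⟩
    when (vanishesOff₂? b a e) (coeffU g (lookup e a +ℕ lookup e b +ℕ 1))
      ≈⟨ coeff-O2 g d (a≢b ∘ Eq.sym) deg≤d e ⟨
    coeff (O2 g d b a) e ∎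

  X : Fin r → Poly r
  X a = embU (0# ∷ 1# ∷ []) a

  const : Carrier → Poly r
  const x = (x , zeroE) ∷ []

  coeff-X-*P : ∀ (a : Fin r) Q e → coeff (X a *P Q) e ≈ when (1 ℕ.≤? lookup e a) (coeff Q (e ⊝ ι a 1))
  coeff-X-*P a Q e = trans (coeff-embU-*P (0# ∷ 1# ∷ []) a Q e)
    (trans (+-cong (trans (+-identityˡ _) (zeroˡ _)) (*-identityˡ _)) (+-identityˡ _))

  coeff-const : ∀ x e → coeff (const {r} x) e ≈ when (zeroE ≟ᵉ e) x
  coeff-const x e = trans (coeff-sumL (const x) e) (+-identityʳ _)

  coeff-X*O2+embU : ∀ (g : UPoly) d {a b : Fin r} → a ≢ b → DegreeAtMost g d → ∀ e →
    coeff ((X a *P O2 g d a b) +P embU g b) e ≈ when (vanishesOff₂? a b e) (coeffU g (lookup e a +ℕ lookup e b))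
  coeff-X*O2+embU g d {a} {b} a≢b deg≤d e =
    trans (coeff-+P (X a *P O2 g d a b) (embU g b) e) (trans (+-cong (coeff-X-*P a (O2 g d a b) e) (coeff-embU g b e)) by-cases)
    where
    agree : ∀ l → l ∉ ｛ a ｝ ∪ ｛ b ｝ → lookup (e ⊝ ι a 1) l ≡ lookup e l
    agree l l∉ab = lookup-⊝ι-other e 1 (l∉ab ∘ inj₁)
    reindex : ∀ A B → B +ℕ A +ℕ 1 ≡ suc A +ℕ B
    reindex = solve-∀
    by-cases : when (1 ℕ.≤? lookup e a) (coeff (O2 g d a b) (e ⊝ ι a 1)) + when (vanishesOff₁? b e) (coeffU g (lookup e b))
             ≈ when (vanishesOff₂? a b e) (coeffU g (lookup e a +ℕ lookup e b))
    by-cases with lookup e a in eₐ≡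
    ... | zero = trans (+-congʳ (when-false λ ())) (trans (+-identityˡ _) (when-⇔ (mk⇔ widen narrow)))
      where
      widen : VanishesOff ｛ b ｝ e → VanishesOff (｛ a ｝ ∪ ｛ b ｝) e
      widen vanishes l l∉ab = vanishes l (l∉ab ∘ inj₂)
      narrow : VanishesOff (｛ a ｝ ∪ ｛ b ｝) e → VanishesOff ｛ b ｝ e
      narrow vanishes l b≢l with a ≟ l
      ... | yes Eq.refl = eₐ≡
      ... | no a≢l = vanishes l [ a≢l , b≢l ]′
    ... | suc A = begin
      when (1 ℕ.≤? suc A) (coeff (O2 g d a b) (e ⊝ ι a 1)) + when (vanishesOff₁? b e) (coeffU g (lookup e b))
        ≈⟨ +-cong (when-true (s≤s z≤n)) (when-false λ vanishes → ℕ.1+n≢0 (Eq.trans (Eq.sym eₐ≡) (vanishes a (a≢b ∘ Eq.sym)))) ⟩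
      coeff (O2 g d a b) (e ⊝ ι a 1) + 0#
        ≈⟨ +-identityʳ _ ⟩
      coeff (O2 g d a b) (e ⊝ ι a 1)
        ≈⟨ coeff-O2 g d a≢b deg≤d (e ⊝ ι a 1) ⟩
      when (vanishesOff₂? a b (e ⊝ ι a 1)) (coeffU g (lookup (e ⊝ ι a 1) b +ℕ lookup (e ⊝ ι a 1) a +ℕ 1))
        ≈⟨ when-⇔ (vanishesOff-agree⇔ (e ⊝ ι a 1) e agree) ⟩
      when (vanishesOff₂? a b e) (coeffU g (lookup (e ⊝ ι a 1) b +ℕ lookup (e ⊝ ι a 1) a +ℕ 1))
        ≡⟨ Eq.cong (λ i → when (vanishesOff₂? a b e) (coeffU g i)) shifted-index ⟩
      when (vanishesOff₂? a b e) (coeffU g (suc A +ℕ lookup e b)) ∎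
      where
      shifted-index : lookup (e ⊝ ι a 1) b +ℕ lookup (e ⊝ ι a 1) a +ℕ 1 ≡ suc A +ℕ lookup e b
      shifted-index = Eq.trans (Eq.cong₂ (λ i j → i +ℕ j +ℕ 1) (lookup-⊝ι-other e 1 a≢b) (Eq.trans (lookup-⊝ι-self e 1) (Eq.cong (_∸ 1) eₐ≡)))
                               (reindex A (lookup e b))

  coeff-embU-∷ : ∀ x h (a : Fin r) e →
    coeff (const x +P (X a *P embU h a)) e ≈ when (vanishesOff₁? a e) (coeffU (x ∷ h) (lookup e a))
  coeff-embU-∷ x h a e =
    trans (coeff-+P (const x) (X a *P embU h a) e) (trans (+-cong (coeff-const x e) (coeff-X-*P a (embU h a) e)) by-cases)
    where
    by-cases : when (zeroE ≟ᵉ e) x + when (1 ℕ.≤? lookup e a) (coeff (embU h a) (e ⊝ ι a 1))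
             ≈ when (vanishesOff₁? a e) (coeffU (x ∷ h) (lookup e a))
    by-cases with lookup e a in eₐ≡
    ... | zero = trans (+-congˡ (when-false λ ())) (trans (+-identityʳ _) (when-⇔ (mk⇔ zero-vanishes vanishes-zero)))
      where
      zero-vanishes : zeroE ≡ e → VanishesOff ｛ a ｝ e
      zero-vanishes Eq.refl l _ = lookup-zeroE l
      vanishes-zero : VanishesOff ｛ a ｝ e → zeroE ≡ e
      vanishes-zero vanishes = lookup-ext λ l → Eq.trans (lookup-zeroE l) (at l (a ≟ l))
        where
        at : ∀ l → Dec (a ≡ l) → 0 ≡ lookup e l
        at l (yes Eq.refl) = Eq.sym eₐ≡
        at l (no a≢l)      = Eq.sym (vanishes l a≢l)
    ... | suc A = begin
      when (zeroE ≟ᵉ e) x + when (1 ℕ.≤? suc A) (coeff (embU h a) (e ⊝ ι a 1))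
        ≈⟨ +-cong (when-false λ { Eq.refl → ℕ.1+n≢0 (Eq.trans (Eq.sym eₐ≡) (lookup-zeroE a)) }) (when-true (s≤s z≤n)) ⟩
      0# + coeff (embU h a) (e ⊝ ι a 1)
        ≈⟨ +-identityˡ _ ⟩
      coeff (embU h a) (e ⊝ ι a 1)
        ≈⟨ coeff-embU h a (e ⊝ ι a 1) ⟩
      when (vanishesOff₁? a (e ⊝ ι a 1)) (coeffU h (lookup (e ⊝ ι a 1) a))
        ≈⟨ when-⇔ (vanishesOff-agree⇔ (e ⊝ ι a 1) e λ l → lookup-⊝ι-other e 1) ⟩
      when (vanishesOff₁? a e) (coeffU h (lookup (e ⊝ ι a 1) a))
        ≡⟨ Eq.cong (λ i → when (vanishesOff₁? a e) (coeffU h i)) (Eq.trans (lookup-⊝ι-self e 1) (Eq.cong (_∸ 1) eₐ≡)) ⟩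
      when (vanishesOff₁? a e) (coeffU h A) ∎

  O2-telescope : ∀ (g : UPoly) d {a b : Fin r} → a ≢ b → DegreeAtMost g d →
    ((X a *P O2 g d a b) +P embU g b) ≈ₚ ((X b *P O2 g d a b) +P embU g a)
  O2-telescope g d {a} {b} a≢b deg≤d = mk≈ₚ λ e → begin
    coeff ((X a *P O2 g d a b) +P embU g b) e
      ≈⟨ coeff-X*O2+embU g d a≢b deg≤d e ⟩
    when (vanishesOff₂? a b e) (coeffU g (lookup e a +ℕ lookup e b))
      ≈⟨ when-⇔ (vanishesOff-∪-comm e) ⟩
    when (vanishesOff₂? b a e) (coeffU g (lookup e a +ℕ lookup e b))
      ≡⟨ Eq.cong (λ i → when (vanishesOff₂? b a e) (coeffU g i)) (ℕ.+-comm (lookup e a) (lookup e b)) ⟩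
    when (vanishesOff₂? b a e) (coeffU g (lookup e b +ℕ lookup e a))
      ≈⟨ coeff-X*O2+embU g d (a≢b ∘ Eq.sym) deg≤d e ⟨
    coeff ((X b *P O2 g d b a) +P embU g a) e
      ≈⟨ coeff-≈ (+P-cong (*P-congˡ (X b) (O2-sym g d (a≢b ∘ Eq.sym) deg≤d)) ≈ₚ-refl) e ⟩
    coeff ((X b *P O2 g d a b) +P embU g a) e ∎

  embU-∷ : ∀ x h (a : Fin r) → embU (x ∷ h) a ≈ₚ (const x +P (X a *P embU h a))
  embU-∷ x h a = mk≈ₚ λ e → trans (coeff-embU (x ∷ h) a e) (sym (coeff-embU-∷ x h a e))

  embU-one : ∀ (a : Fin r) → embU (1# ∷ []) a ≈ₚ oneP
  embU-one a = ≡⇒≈ₚ (Eq.cong (λ u → (1# , u) ∷ []) (lookup-ext λ l → Eq.trans (at l (a ≟ l)) (Eq.sym (lookup-zeroE l))))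
    where
    at : ∀ l → Dec (a ≡ l) → lookup (ι a 0) l ≡ 0
    at l (yes Eq.refl) = lookup-ι-self {a = a} 0
    at l (no a≢l)      = lookup-ι-other 0 a≢l

  coeffU-map-applyUpTo : ∀ (φ : ℕ → Carrier) (s : ℕ → ℕ) N k → coeffU (map φ (applyUpTo s N)) k ≈ when (k ℕ.<? N) (φ (s k))
  coeffU-map-applyUpTo φ s zero    k       = sym (when-false λ ())
  coeffU-map-applyUpTo φ s (suc N) zero    = sym (when-true z<s)
  coeffU-map-applyUpTo φ s (suc N) (suc k) =
    trans (coeffU-map-applyUpTo φ (s ∘ suc) N k) (when-⇔ (mk⇔ s≤s s≤s⁻¹))

  mulU-isProduct : ∀ g h → IsProduct (mulU g h) g h
  mulU-isProduct g h k = trans (coeffU-map-applyUpTo _ (λ i → i) (length g +ℕ length h) k) (when-redundant beyond)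
    where
    beyond : ¬ k < length g +ℕ length h → sumR (suc k) (λ j → coeffU g j * coeffU h (k ∸ j)) ≈ 0#
    beyond k≮len = sumR-zero (suc k) term-vanishes
      where
      term-vanishes : ∀ j → j < suc k → coeffU g j * coeffU h (k ∸ j) ≈ 0#
      term-vanishes j _ with j ℕ.<? length g
      ... | no j≮len-g = trans (*-congʳ (coeffU-length g (ℕ.≮⇒≥ j≮len-g))) (zeroˡ _)
      ... | yes j<len-g = trans (*-congˡ (coeffU-length h (ℕ.m+n≤o⇒m≤o∸n (length h) len-h+j≤k))) (zeroʳ _)
        where
        len-h+j≤k : length h +ℕ j ≤ k
        len-h+j≤k = ℕ.≤-trans (ℕ.≤-reflexive (ℕ.+-comm (length h) j))
                      (ℕ.≤-trans (ℕ.+-monoˡ-≤ (length h) (ℕ.<⇒≤ j<len-g)) (ℕ.≮⇒≥ k≮len))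

  weilOperator-product : ∀ {g : UPoly} {d} s {O : Poly (suc s)} → IsWeilOp g d (suc s) O →
    ∃ λ A → O ≈ₚ (prodP (λ (j : Fin s) → O2 g d (inject₁ j) (fromℕ s)) +P (A *P embU g (fromℕ s)))
  weilOperator-product zero                (lift O≋1)  = [] , ≈ₚ-trans (mk≈ₚ O≋1) (≈ₚ-sym (+P-identityʳ oneP))
  weilOperator-product {g = g} {d} (suc zero) (lift O≋O2) =
    [] , ≈ₚ-trans (mk≈ₚ O≋O2) (≈ₚ-sym (≈ₚ-trans (+P-identityʳ (O12 *P oneP)) (*P-identityʳ O12)))
    where
    O12 = O2 g d fzero (fsuc fzero)
  weilOperator-product (suc (suc s)) (_ , A , O≋) = A , mk≈ₚ O≋

module Quotient {c ℓ : Level} (R : CommutativeRing c ℓ) {k : ℕ} (g : Fin k → CommutativeRing.Carrier R) where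
  open CommutativeRing R
  open import Algebra.Properties.Semiring.Sum semiring using (sum; sum-cong-≋; sum-replicate-zero; ∑-distrib-+; *-distribˡ-sum)
  open import Algebra.Properties.Ring ring using (-1*x≈-x)
  open import Algebra.Properties.AbelianGroup +-abelianGroup using (⁻¹-∙-comm)
  open import Algebra.Properties.CommutativeSemigroup +-commutativeSemigroup using () renaming (interchange to +-interchange)
  open import Relation.Binary.Reasoning.Setoid setoid

  combination : (Fin k → Carrier) → Carrier
  combination a = sum λ i → a i * g i

  combination-zero : combination (λ _ → 0#) ≈ 0#
  combination-zero = trans (sum-cong-≋ λ i → zeroˡ (g i)) (sum-replicate-zero k)

  combination-+ : ∀ a b → combination (λ i → a i + b i) ≈ combination a + combination b
  combination-+ a b = trans (sum-cong-≋ λ i → distribʳ (g i) (a i) (b i)) (∑-distrib-+ {k} (λ i → a i * g i) (λ i → b i * g i))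

  *-combination : ∀ x a → x * combination a ≈ combination (λ i → x * a i)
  *-combination x a = trans (*-distribˡ-sum {k} x (λ i → a i * g i)) (sum-cong-≋ λ i → sym (*-assoc x (a i) (g i)))

  -‿combination : ∀ a → - combination a ≈ combination (λ i → - a i)
  -‿combination a = begin
    - combination a                    ≈⟨ -1*x≈-x _ ⟨
    - 1# * combination a               ≈⟨ *-combination (- 1#) a ⟩
    combination (λ i → - 1# * a i)     ≈⟨ sum-cong-≋ (λ i → *-congʳ (-1*x≈-x (a i))) ⟩
    combination (λ i → - a i)          ∎

  basis : ∀ {n} → Fin n → Fin n → Carrier
  basis fzero    fzero    = 1#
  basis fzero    (fsuc _) = 0#
  basis (fsuc _) fzero    = 0#
  basis (fsuc i) (fsuc j) = basis i j

  sum-basis : ∀ {n} (i : Fin n) (h : Fin n → Carrier) → sum (λ j → basis i j * h j) ≈ h i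
  sum-basis {suc n} fzero h =
    trans (+-cong (*-identityˡ _) (trans (sum-cong-≋ λ j → zeroˡ (h (fsuc j))) (sum-replicate-zero n))) (+-identityʳ _)
  sum-basis (fsuc i) h    = trans (+-cong (zeroˡ _) (sum-basis i (h ∘ fsuc))) (+-identityˡ _)

  infix 4 _∼_
  _∼_ : Rel Carrier (c ⊔ ℓ)
  x ∼ y = ∃ λ a → x ≈ y + combination a

  ≈⇒∼ : ∀ {x y} → x ≈ y → x ∼ y
  ≈⇒∼ {x} {y} x≈y = (λ _ → 0#) , (begin
    x                       ≈⟨ x≈y ⟩
    y                       ≈⟨ +-identityʳ y ⟨
    y + 0#                  ≈⟨ +-congˡ combination-zero ⟨
    y + combination (λ _ → 0#) ∎)

  ∼-sym : ∀ {x y} → x ∼ y → y ∼ x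
  ∼-sym {x} {y} (a , x≈y+a) = (λ i → - a i) , (begin
    y                                   ≈⟨ +-identityʳ y ⟨
    y + 0#                              ≈⟨ +-congˡ (-‿inverseʳ _) ⟨
    y + (combination a - combination a) ≈⟨ +-assoc _ _ _ ⟨
    y + combination a - combination a   ≈⟨ +-cong x≈y+a (sym (-‿combination a)) ⟨
    x + combination (λ i → - a i)       ∎)

  ∼-trans : ∀ {x y z} → x ∼ y → y ∼ z → x ∼ z
  ∼-trans {x} {y} {z} (a , x≈y+a) (b , y≈z+b) = (λ i → b i + a i) , (begin
    x                                   ≈⟨ x≈y+a ⟩
    y + combination a                   ≈⟨ +-congʳ y≈z+b ⟩
    z + combination b + combination a   ≈⟨ +-assoc _ _ _ ⟩
    z + (combination b + combination a) ≈⟨ +-congˡ (combination-+ b a) ⟨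
    z + combination (λ i → b i + a i)   ∎)

  ∼-isEquivalence : IsEquivalence _∼_
  ∼-isEquivalence = record { refl = ≈⇒∼ refl ; sym = ∼-sym ; trans = ∼-trans }

  +-cong∼ : ∀ {x x′ y y′} → x ∼ x′ → y ∼ y′ → x + y ∼ x′ + y′
  +-cong∼ {x} {x′} {y} {y′} (a , x≈x′+a) (b , y≈y′+b) = (λ i → a i + b i) , (begin
    x + y                                           ≈⟨ +-cong x≈x′+a y≈y′+b ⟩
    (x′ + combination a) + (y′ + combination b)     ≈⟨ +-interchange _ _ _ _ ⟩
    (x′ + y′) + (combination a + combination b)     ≈⟨ +-congˡ (combination-+ a b) ⟨
    (x′ + y′) + combination (λ i → a i + b i)       ∎)

  -‿cong∼ : ∀ {x y} → x ∼ y → - x ∼ - y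
  -‿cong∼ {x} {y} (a , x≈y+a) = (λ i → - a i) , (begin
    - x                             ≈⟨ -‿cong x≈y+a ⟩
    - (y + combination a)           ≈⟨ ⁻¹-∙-comm y (combination a) ⟨
    - y - combination a             ≈⟨ +-congˡ (-‿combination a) ⟩
    - y + combination (λ i → - a i) ∎)

  *-congʳ∼ : ∀ {x x′} y → x ∼ x′ → x * y ∼ x′ * y
  *-congʳ∼ {x} {x′} y (a , x≈x′+a) = (λ i → y * a i) , (begin
    x * y                               ≈⟨ *-congʳ x≈x′+a ⟩
    (x′ + combination a) * y            ≈⟨ distribʳ y x′ (combination a) ⟩
    x′ * y + combination a * y          ≈⟨ +-congˡ (*-comm _ y) ⟩
    x′ * y + y * combination a          ≈⟨ +-congˡ (*-combination y a) ⟩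
    x′ * y + combination (λ i → y * a i) ∎)

  *-cong∼ : ∀ {x x′ y y′} → x ∼ x′ → y ∼ y′ → x * y ∼ x′ * y′
  *-cong∼ {x} {x′} {y} {y′} x∼x′ y∼y′ =
    ∼-trans (*-congʳ∼ y x∼x′) (∼-trans (≈⇒∼ (*-comm x′ y)) (∼-trans (*-congʳ∼ x′ y∼y′) (≈⇒∼ (*-comm y′ x′))))

  generator∼0 : ∀ i → g i ∼ 0#
  generator∼0 i = basis i , trans (sym (sum-basis i g)) (sym (+-identityˡ _))

  quotientRing : CommutativeRing c (c ⊔ ℓ)
  quotientRing = record
    { Carrier = Carrier
    ; _≈_ = _∼_
    ; _+_ = _+_
    ; _*_ = _*_
    ; -_ = -_
    ; 0# = 0#
    ; 1# = 1#
    ; isCommutativeRing = record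
      { isRing = record
        { +-isAbelianGroup = record
          { isGroup = record
            { isMonoid = record
              { isSemigroup = record
                { isMagma = record { isEquivalence = ∼-isEquivalence ; ∙-cong = +-cong∼ }
                ; assoc = λ x y z → ≈⇒∼ (+-assoc x y z)
                }
              ; identity = ≈⇒∼ ∘ +-identityˡ , ≈⇒∼ ∘ +-identityʳ
              }
            ; inverse = ≈⇒∼ ∘ -‿inverseˡ , ≈⇒∼ ∘ -‿inverseʳ
            ; ⁻¹-cong = -‿cong∼
            }
          ; comm = λ x y → ≈⇒∼ (+-comm x y)
          }
        ; *-cong = *-cong∼
        ; *-assoc = λ x y z → ≈⇒∼ (*-assoc x y z)
        ; *-identity = ≈⇒∼ ∘ *-identityˡ , ≈⇒∼ ∘ *-identityʳ
        ; distrib = (λ x y z → ≈⇒∼ (distribˡ x y z)) , (λ x y z → ≈⇒∼ (distribʳ x y z))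
        }
      ; *-comm = λ x y → ≈⇒∼ (*-comm x y)
      }
    }

module Congruences {c ℓ : Level} (F : CommutativeRing c ℓ) (m : Poly.UPoly F) (dm : ℕ)
                   (m-deg : OperatorIdentities.DegreeAtMost F m dm) (r : ℕ) where
  open Poly F using (UPoly; Poly; embU; O2; prodP; sumP; powU; IsProduct; CongAll; _≋_)
  open PolynomialRing F using (polynomialRing; mk≈ₚ)
  open OperatorIdentities F using (DegreeAtMost; X; const; O2-telescope; O2-*P; embU-∷; embU-*P; embU-one; mulU-isProduct)
  open Quotient (polynomialRing r) (λ i → embU m i) public using (_∼_; quotientRing; ≈⇒∼; generator∼0)
  -- Here _≈_ is _∼_, congruence modulo (m(X_1), …, m(X_r)).  Implicit arguments that occur
  -- only under the polynomial operations cannot be found by unification (these operations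
  -- compute), so they are passed by name.
  open CommutativeRing quotientRing
  open import Algebra.Properties.Semiring.Sum (CommutativeRing.semiring (polynomialRing r)) using (sum)
  open import Algebra.Properties.CommutativeSemigroup *-commutativeSemigroup using (x∙yz≈y∙xz; interchange)
  open import Relation.Binary.Reasoning.Setoid setoid

  X-O2-swap : ∀ {a b} → a ≢ b → X a * O2 m dm a b ∼ X b * O2 m dm a b
  X-O2-swap {a} {b} a≢b = begin
    X a * O2 m dm a b             ≈⟨ +-identityʳ (X a * O2 m dm a b) ⟨
    X a * O2 m dm a b + 0#        ≈⟨ +-congˡ {x = X a * O2 m dm a b} (generator∼0 b) ⟨
    X a * O2 m dm a b + embU m b  ≈⟨ ≈⇒∼ (O2-telescope m dm a≢b m-deg) ⟩
    X b * O2 m dm a b + embU m a  ≈⟨ +-congˡ {x = X b * O2 m dm a b} (generator∼0 a) ⟩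
    X b * O2 m dm a b + 0#        ≈⟨ +-identityʳ (X b * O2 m dm a b) ⟩
    X b * O2 m dm a b             ∎

  embU-O2-swap : ∀ {a b} → a ≢ b → ∀ h → embU h a * O2 m dm a b ∼ embU h b * O2 m dm a b
  embU-O2-swap a≢b []      = refl
  embU-O2-swap {a} {b} a≢b (x ∷ h) = begin
    embU (x ∷ h) a * O                      ≈⟨ *-congʳ {x = O} (≈⇒∼ (embU-∷ x h a)) ⟩
    (const x + X a * embU h a) * O          ≈⟨ distribʳ O (const x) (X a * embU h a) ⟩
    const x * O + (X a * embU h a) * O      ≈⟨ +-congˡ {x = const x * O} (*-assoc (X a) (embU h a) O) ⟩
    const x * O + X a * (embU h a * O)      ≈⟨ +-congˡ {x = const x * O} (*-congˡ {x = X a} (embU-O2-swap a≢b h)) ⟩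
    const x * O + X a * (embU h b * O)      ≈⟨ +-congˡ {x = const x * O} (x∙yz≈y∙xz (X a) (embU h b) O) ⟩
    const x * O + embU h b * (X a * O)      ≈⟨ +-congˡ {x = const x * O} (*-congˡ {x = embU h b} (X-O2-swap a≢b)) ⟩
    const x * O + embU h b * (X b * O)      ≈⟨ +-congˡ {x = const x * O} (x∙yz≈y∙xz (embU h b) (X b) O) ⟩
    const x * O + X b * (embU h b * O)      ≈⟨ +-congˡ {x = const x * O} (*-assoc (X b) (embU h b) O) ⟨
    const x * O + (X b * embU h b) * O      ≈⟨ distribʳ O (const x) (X b * embU h b) ⟨
    (const x + X b * embU h b) * O          ≈⟨ *-congʳ {x = O} (≈⇒∼ (embU-∷ x h b)) ⟨
    embU (x ∷ h) b * O                      ∎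
    where
    O = O2 m dm a b

  embU-prodO2-swap : ∀ {k} (idx : Fin k → Fin r) L → (∀ j → idx j ≢ L) → ∀ h j₀ →
    embU h (idx j₀) * prodP (λ j → O2 m dm (idx j) L) ∼ embU h L * prodP (λ j → O2 m dm (idx j) L)
  embU-prodO2-swap idx L idx≢L h fzero = begin
    embU h (idx fzero) * (O * Π)      ≈⟨ *-assoc (embU h (idx fzero)) O Π ⟨
    (embU h (idx fzero) * O) * Π      ≈⟨ *-congʳ {x = Π} (embU-O2-swap (idx≢L fzero) h) ⟩
    (embU h L * O) * Π                ≈⟨ *-assoc (embU h L) O Π ⟩
    embU h L * (O * Π)                ∎
    where
    O = O2 m dm (idx fzero) L
    Π = prodP (λ j → O2 m dm (idx (fsuc j)) L)
  embU-prodO2-swap idx L idx≢L h (fsuc j₀) = begin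
    embU h (idx (fsuc j₀)) * (O * Π)  ≈⟨ x∙yz≈y∙xz (embU h (idx (fsuc j₀))) O Π ⟩
    O * (embU h (idx (fsuc j₀)) * Π)  ≈⟨ *-congˡ {x = O} (embU-prodO2-swap (idx ∘ fsuc) L (idx≢L ∘ fsuc) h j₀) ⟩
    O * (embU h L * Π)                ≈⟨ x∙yz≈y∙xz O (embU h L) Π ⟩
    embU h L * (O * Π)                ∎
    where
    O = O2 m dm (idx fzero) L
    Π = prodP (λ j → O2 m dm (idx (fsuc j)) L)

  embU-multiple∼0 : ∀ {f n : UPoly} → IsProduct f m n → ∀ a → embU f a ∼ 0#
  embU-multiple∼0 {f} {n} f≈mn a = begin
    embU f a              ≈⟨ ≈⇒∼ (embU-*P {f = f} {g = m} {h = n} f≈mn a) ⟩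
    embU m a * embU n a   ≈⟨ *-congʳ {x = embU n a} (generator∼0 a) ⟩
    0# * embU n a         ≈⟨ zeroˡ (embU n a) ⟩
    0#                    ∎

  module _ {f n : UPoly} {df dn} (f≈mn : IsProduct f m n) (f-deg : DegreeAtMost f df) (n-deg : DegreeAtMost n dn) where

    O2-factor : ∀ {a b} → a ≢ b → O2 f df a b ∼ embU n a * O2 m dm a b
    O2-factor {a} {b} a≢b = begin
      O2 f df a b
        ≈⟨ ≈⇒∼ (O2-*P {f = f} {m = m} {n = n} {df = df} {dm = dm} {dn = dn} a≢b f-deg m-deg n-deg f≈mn) ⟩
      embU n a * O2 m dm a b + embU m b * O2 n dn b a
        ≈⟨ +-congˡ {x = embU n a * O2 m dm a b} (*-congʳ {x = O2 n dn b a} (generator∼0 b)) ⟩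
      embU n a * O2 m dm a b + 0# * O2 n dn b a
        ≈⟨ +-congˡ {x = embU n a * O2 m dm a b} (zeroˡ (O2 n dn b a)) ⟩
      embU n a * O2 m dm a b + 0#
        ≈⟨ +-identityʳ (embU n a * O2 m dm a b) ⟩
      embU n a * O2 m dm a b ∎

    prodO2-factor : ∀ {k} (idx : Fin k → Fin r) L → (∀ j → idx j ≢ L) →
      prodP (λ j → O2 f df (idx j) L) ∼ embU (powU n k) L * prodP (λ j → O2 m dm (idx j) L)
    prodO2-factor {zero} idx L _ = begin
      1#                         ≈⟨ *-identityʳ 1# ⟨
      1# * 1#                    ≈⟨ *-congʳ {x = 1#} (≈⇒∼ (embU-one L)) ⟨
      embU (powU n 0) L * 1#     ∎
    prodO2-factor {suc k} idx L idx≢L = begin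
      O2 f df x L * Πf
        ≈⟨ *-cong (O2-factor (idx≢L fzero)) (prodO2-factor (idx ∘ fsuc) L (idx≢L ∘ fsuc)) ⟩
      (embU n x * O) * (embU (powU n k) L * Π)
        ≈⟨ *-congʳ {x = embU (powU n k) L * Π} (embU-O2-swap (idx≢L fzero) n) ⟩
      (embU n L * O) * (embU (powU n k) L * Π)
        ≈⟨ interchange (embU n L) O (embU (powU n k) L) Π ⟩
      (embU n L * embU (powU n k) L) * (O * Π)
        ≈⟨ *-congʳ {x = O * Π} (≈⇒∼ (embU-*P {f = powU n (suc k)} {g = n} {h = powU n k} (mulU-isProduct n (powU n k)) L)) ⟨
      embU (powU n (suc k)) L * (O * Π) ∎
      where
      x = idx fzero
      O = O2 m dm x L
      Π = prodP (λ j → O2 m dm (idx (fsuc j)) L)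
      Πf = prodP (λ j → O2 f df (idx (fsuc j)) L)

  sum≡sumP : ∀ {k} (A : Fin k → Poly r) → sum A ≡ sumP A
  sum≡sumP {zero}  A = Eq.refl
  sum≡sumP {suc k} A = Eq.cong (A fzero +_) (sum≡sumP (A ∘ fsuc))

  ∼⇒CongAll : ∀ P Q → P ∼ Q → CongAll m P Q
  ∼⇒CongAll P Q (A , mk≈ₚ P≋Q+A) = A , Eq.subst (λ S → P ≋ (Q + S)) (sum≡sumP (λ i → A i * embU m i)) P≋Q+A

  CongAll⇒∼ : ∀ P Q → CongAll m P Q → P ∼ Q
  CongAll⇒∼ P Q (A , P≋Q+A) = A , mk≈ₚ (Eq.subst (λ S → P ≋ (Q + S)) (Eq.sym (sum≡sumP (λ i → A i * embU m i))) P≋Q+A)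

module WeilOperators {c ℓ : Level} (F : CommutativeRing c ℓ) (m : Poly.UPoly F) (dm : ℕ)
                     (m-deg : OperatorIdentities.DegreeAtMost F m dm) (s : ℕ) where
  open Poly F using (UPoly; Poly; embU; O2; prodP; IsWeilOp)
  open OperatorIdentities F using (weilOperator-product)
  open Congruences F m dm m-deg (suc s)
  open CommutativeRing quotientRing
  open import Relation.Binary.Reasoning.Setoid setoid

  top : Fin (suc s)
  top = fromℕ s

  inject₁≢top : ∀ j → inject₁ j ≢ top
  inject₁≢top j = fromℕ≢inject₁ ∘ Eq.sym

  weilProduct : UPoly → ℕ → Poly (suc s)
  weilProduct g d = prodP (λ (j : Fin s) → O2 g d (inject₁ j) top)

  weilOperator∼product : ∀ {g d} {O : Poly (suc s)} → IsWeilOp g d (suc s) O → embU g top ∼ 0# → O ∼ weilProduct g d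
  weilOperator∼product {g} {d} {O} O-weil g∼0 with weilOperator-product s O-weil
  ... | A , O≈Π+A*g = begin
    O                                ≈⟨ ≈⇒∼ O≈Π+A*g ⟩
    weilProduct g d + A * embU g top ≈⟨ +-congˡ {x = weilProduct g d} (*-congˡ {x = A} g∼0) ⟩
    weilProduct g d + A * 0#         ≈⟨ +-congˡ {x = weilProduct g d} (zeroʳ A) ⟩
    weilProduct g d + 0#             ≈⟨ +-identityʳ (weilProduct g d) ⟩
    weilProduct g d                  ∎

  embU-weilProduct-top : ∀ h i → embU h i * weilProduct m dm ∼ embU h top * weilProduct m dm
  embU-weilProduct-top h i with view i
  ... | ‵fromℕ     = refl
  ... | ‵inject₁ j = embU-prodO2-swap inject₁ top inject₁≢top h j

corollary2p17 : ∀ {c ℓ : Level} (F : CommutativeRing c ℓ) → IsFiniteField F →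
    let open Poly F in
    (r : ℕ) → 1 ≤ r →
    (𝔪 𝔫 𝔣 : UPoly) (dm dn df : ℕ) →
    Monic 𝔪 dm → 1 ≤ dm → Monic 𝔫 dn → Monic 𝔣 df → IsProduct 𝔣 𝔪 𝔫 →
    (Om : Poly r) → IsWeilOp 𝔪 dm r Om →
    (Of : Poly r) → IsWeilOp 𝔣 df r Of →
    (i : Fin r) (B : Poly r) → IsStar 𝔪 dm (powU 𝔫 (r ∸ 1)) i Om B →
    CongAll 𝔪 B Of
corollary2p17 F _ (suc s) _ m n f dm dn df m-monic _ n-monic f-monic f≈mn Om Om-weil Of Of-weil i B (_ , B≡nˢOm) =
  ∼⇒CongAll B Of (begin
    B
      ≈⟨ CongAll⇒∼ B (embU (powU n s) i * Om) B≡nˢOm ⟩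
    embU (powU n s) i * Om
      ≈⟨ *-congˡ {x = embU (powU n s) i} (weilOperator∼product Om-weil (generator∼0 top)) ⟩
    embU (powU n s) i * weilProduct m dm
      ≈⟨ embU-weilProduct-top (powU n s) i ⟩
    embU (powU n s) top * weilProduct m dm
      ≈⟨ prodO2-factor {f = f} {n = n} {df} {dn} f≈mn (proj₂ f-monic) (proj₂ n-monic) inject₁ top inject₁≢top ⟨
    weilProduct f df
      ≈⟨ weilOperator∼product Of-weil (embU-multiple∼0 {n = n} f≈mn top) ⟨
    Of ∎)
  where
  open Poly F using (embU; powU)
  open WeilOperators F m dm (proj₂ m-monic) s
  open Congruences F m dm (proj₂ m-monic) (suc s)
  open CommutativeRing quotientRing
  open import Relation.Binary.Reasoning.Setoid setoid
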